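{- Let $R$ be a finite generalized root system over $\mathfrak{a}$, with labeling and notation as in the context. (1) If $\mathrm{rank}_{\mathbb{Z}}\mathfrak{a}=1$ and $\mathfrak{a}=\mathbb{Z}\alpha$, then $R=\{\alpha,-\alpha\}$, the vertex set of $\Gamma(R)$ is $\{\{\alpha\},\{ -\alpha\}\}$ and its edge set consists of the single edge $\{\{\alpha\},\{ -\alpha\}\}$; and with $I=\{1\}$, $1^{\{\alpha\}}\cdot s_1s_1$ is a Hamiltonian cycle of $\Gamma(R)$. (2) If $\mathrm{rank}_{\mathbb{Z}}\mathfrak{a}=2$, let $I=\{1,2\}$, $k:=\frac12|\mathbb{B}(R)|$ (a positive integer), and $i_{2t-1}:=1$, $i_{2t}:=2$ for $t\in\{1,\dots,k\}$. Then for every $B\in\mathbb{B}(R)$, $1^B\cdot s_{i_1}s_{i_2}\cdots s_{i_{2k}}$ is a Hamiltonian cycle of $\Gamma(R)$.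
   Context: $\mathfrak{a}$ is a nonzero free $\mathbb{Z}$-module of finite rank. For $R\subset\mathfrak{a}$ and a $\mathbb{Z}$-basis $B$ put $R^\pm_B:=R\cap\mathrm{Span}_{\pm\mathbb{Z}_{\ge0}}B$; $\mathbb{B}(R)$ is the set of $\mathbb{Z}$-bases $B\subset R$ of $\mathfrak{a}$ with $R=R^+_B\cup R^-_B$. A finite subset $R$ is an FGRS if $\mathbb{B}(R)\ne\emptyset$, $R\cap\mathbb{Z}\alpha=\{\pm\alpha\}$ for all $\alpha\in R$, and for all $B\in\mathbb{B}(R)$, $\alpha\in B$ there is $B^{(\alpha)}\in\mathbb{B}(R)$ with $R^+_{B^{(\alpha)}}\cap R^-_B=\{ -\alpha\}$. Fix a finite set $I$ and a labeling $B=\{\alpha^B_i\mid i\in I\}$ of each $B\in\mathbb{B}(R)$ such that, writing $B^{(i)}:=B^{(\alpha^B_i)}$, one has $\alpha^{B^{(i)}}_j=\alpha^B_j+N\,\alpha^B_i$ for an integer $N=N^B_{ij}$ (with $N^B_{ii}=-2$). The Cayley graph $\Gamma(R)$ has vertex set $V(R)=\mathbb{B}(R)$ and edge set $E(R)=\{\{B,B^{(i)}\}\mid B\in V(R),i\in I\}$. For $B\in V(R)$ and $i_1,\dots,i_k\in I$, set $B_0:=B$, $B_t:=B_{t-1}^{(i_t)}$; the symbol $1^B\cdot s_{i_1}\cdots s_{i_k}$ is called a Hamiltonian cycle of $\Gamma(R)$ if $k=|V(R)|$, $B_k=B$ and $V(R)=\{B_t\mid 1\le t\le k\}$ (then $t\mapsto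 B_{t-1}$ is a Hamiltonian cycle in the graph-theoretic sense: a cyclic ordering of all vertices with consecutive vertices adjacent). -}

module Defs where

open import Data.Nat using (ℕ; zero; suc; _*_)
open import Data.Integer as ℤ using (ℤ; 0ℤ; 1ℤ; -1ℤ; -_) renaming (_+_ to _+ℤ_; _*_ to _*ℤ_; _≤_ to _≤ℤ_)
open import Data.Fin using (Fin; zero; suc)
open import Data.Fin.Subset using (Subset; _∈_; _∉_)
open import Data.Vec using (Vec; []; _∷_; zipWith; map; replicate; lookup)
open import Data.List using (List; []; _∷_; length; foldl)
open import Data.List.Relation.Unary.Any using (Any)
open import Data.Product using (Σ; ∃; _×_; _,_)
open import Data.Sum using (_⊎_)
open import Function using (_∘_)
open import Function.Bundles using (_⇔_)
open import Relation.Binary.PropositionalEquality using (_≡_)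

-- The lattice 𝔞 of rank n is modelled as ℤ^n = Vec ℤ n.

_+ᵥ_ : {n : ℕ} → Vec ℤ n → Vec ℤ n → Vec ℤ n
_+ᵥ_ = zipWith _+ℤ_

_·ᵥ_ : {n : ℕ} → ℤ → Vec ℤ n → Vec ℤ n
z ·ᵥ v = map (z *ℤ_) v

-ᵥ_ : {n : ℕ} → Vec ℤ n → Vec ℤ n
-ᵥ v = map -_ v

0ᵥ : {n : ℕ} → Vec ℤ n
0ᵥ {n} = replicate n 0ℤ

-- A finite subset R ⊂ 𝔞 is given by a duplicate-free enumeration
-- R : Vec (Vec ℤ n) m; subsets of R are then 'Subset m'.

comb : {n m : ℕ} → Vec (Vec ℤ n) m → (Fin m → ℤ) → Vec ℤ n
comb []      c = 0ᵥ
comb (x ∷ R) c = (c zero ·ᵥ x) +ᵥ comb R (c ∘ suc)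

Distinct : {n m : ℕ} → Vec (Vec ℤ n) m → Set
Distinct {m = m} R = (j j' : Fin m) → lookup R j ≡ lookup R j' → j ≡ j'

_∈R_ : {n m : ℕ} → Vec ℤ n → Vec (Vec ℤ n) m → Set
v ∈R R = ∃ λ j → lookup R j ≡ v

module _ {n m : ℕ} (R : Vec (Vec ℤ n) m) where

  Supp : (Fin m → ℤ) → Subset m → Set
  Supp c S = (j : Fin m) → j ∉ S → c j ≡ 0ℤ

  IsZBasis : Subset m → Set
  IsZBasis S =
    ((v : Vec ℤ n) → ∃ λ c → Supp c S × comb R c ≡ v) ×
    ((c c' : Fin m → ℤ) → Supp c S → Supp c' S → comb R c ≡ comb R c' →
       (j : Fin m) → c j ≡ c' j)

  Pos : Subset m → Fin m → Set
  Pos S j = ∃ λ c → Supp c S × ((j' : Fin m) → 0ℤ ≤ℤ c j') × comb R c ≡ lookup R j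

  Neg : Subset m → Fin m → Set
  Neg S j = ∃ λ c → Supp c S × ((j' : Fin m) → c j' ≤ℤ 0ℤ) × comb R c ≡ lookup R j

  𝔹 : Subset m → Set
  𝔹 S = IsZBasis S × ((j : Fin m) → Pos S j ⊎ Neg S j)

  Reduced : Set
  Reduced =
    ((j : Fin m) → (-ᵥ lookup R j) ∈R R) ×
    ((j j' : Fin m) (z : ℤ) → lookup R j' ≡ z ·ᵥ lookup R j → z ≡ 1ℤ ⊎ z ≡ -1ℤ)

  IsFGRS : Set
  IsFGRS =
    (∃ λ S → 𝔹 S) × Reduced ×
    ((S : Subset m) → 𝔹 S → (j : Fin m) → j ∈ S →
      ∃ λ S' → 𝔹 S' ×
        ((j' : Fin m) → (Pos S' j' × Neg S j') ⇔ (lookup R j' ≡ -ᵥ lookup R j)))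

  -- A labeling with index set I = Fin k: lab S i is (the index in R of) α^S_i,
  -- ref S i is B^{(i)} = B^{(α^B_i)}.
  record Labeling (k : ℕ) : Set where
    field
      lab : Subset m → Fin k → Fin m
      ref : Subset m → Fin k → Subset m
      lab-inj  : (S : Subset m) → 𝔹 S → (i i' : Fin k) → lab S i ≡ lab S i' → i ≡ i'
      lab-onto : (S : Subset m) → 𝔹 S → (j : Fin m) → j ∈ S ⇔ (∃ λ i → lab S i ≡ j)
      ref-𝔹    : (S : Subset m) → 𝔹 S → (i : Fin k) → 𝔹 (ref S i)
      ref-spec : (S : Subset m) → 𝔹 S → (i : Fin k) → (j' : Fin m) →
                   (Pos (ref S i) j' × Neg S j') ⇔ (lookup R j' ≡ -ᵥ lookup R (lab S i))
      ref-lab  : (S : Subset m) → 𝔹 S → (i j : Fin k) → ∃ λ (N : ℤ) →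
                   (i ≡ j → N ≡ - ℤ.+ 2) ×
                   (lookup R (lab (ref S i) j) ≡ lookup R (lab S j) +ᵥ (N ·ᵥ lookup R (lab S i)))

  HasSize : (Subset m → Set) → ℕ → Set
  HasSize P L = ∃ λ (f : Fin L → Subset m) →
    ((t t' : Fin L) → f t ≡ f t' → t ≡ t') × ((S : Subset m) → P S ⇔ (∃ λ t → f t ≡ S))

  module _ {k : ℕ} (Λ : Labeling k) where
    open Labeling Λ

    walk : Subset m → List (Fin k) → List (Subset m)
    walk S []       = []
    walk S (i ∷ is) = ref S i ∷ walk (ref S i) is

    endpoint : Subset m → List (Fin k) → Subset m
    endpoint S is = foldl ref S is

    InWalk : Subset m → List (Fin k) → Subset m → Set
    InWalk S is S' = Any (S' ≡_) (walk S is)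

    Hamiltonian : Subset m → List (Fin k) → Set
    Hamiltonian S is =
      HasSize 𝔹 (length is) × endpoint S is ≡ S ×
      ((S' : Subset m) → 𝔹 S' ⇔ InWalk S is S')

    Edge : Subset m → Subset m → Set
    Edge S T = ∃ λ S₀ → 𝔹 S₀ × ∃ λ i →
      (S ≡ S₀ × T ≡ ref S₀ i) ⊎ (T ≡ S₀ × S ≡ ref S₀ i)

IsSingleton : {n m : ℕ} → Vec (Vec ℤ n) m → Vec ℤ n → Subset m → Set
IsSingleton {m = m} R v S = (j : Fin m) → j ∈ S ⇔ (lookup R j ≡ v)

-- i_1 i_2 … i_{2K} = 1 2 1 2 … 1 2   (with 1 = zero, 2 = suc zero in Fin 2)
alternating : ℕ → List (Fin 2)
alternating zero    = []
alternating (suc K) = zero ∷ suc zero ∷ alternating K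

-- A basis S is determined by its positive roots, and reflecting S in its label i turns the
-- positive root α_i negative and keeps every other positive root positive. With one label this
-- leaves only the bases {α} and {-α}. With two labels, reflect alternately in labels 1 and 2,
-- starting from S. The label about to be reflected is still positive for S during the first
-- K = |R|/2 steps, since otherwise both labels, hence all positive roots of the current basis,
-- would be negative for S; so each step adds one inversion with respect to S, and after K steps
-- the walk reaches the opposite basis S', from which K more steps lead back to S. The 2K bases on
-- this cycle are distinct (inversion counts with respect to S and S', and the sign of the last
-- label reflected in), and every basis lies on it, by induction on its inversions with respect to S.

{-# OPTIONS --safe #-}
module Submission where

open import Defs
open import Data.Nat using (ℕ; zero; suc; _*_; _≤_)
open import Data.Integer using (ℤ)
open import Data.Fin using (Fin; zero; suc)
open import Data.Fin.Subset using (Subset)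
open import Data.Vec using (Vec)
open import Data.List using ([]; _∷_)
open import Data.Product using (∃; _×_; _,_)
open import Data.Sum using (_⊎_)
open import Function.Bundles using (_⇔_)
open import Relation.Binary.PropositionalEquality using (_≡_)

open import Data.Empty using (⊥; ⊥-elim)
open import Data.Fin using (toℕ; fromℕ<)
open import Data.Fin.Permutation using (permutation)
open import Data.Fin.Properties using (_≟_; any?)
import Data.Fin.Properties as Fin
open import Data.Fin.Subset using (_∈_)
open import Data.Fin.Subset.Properties using (_∈?_; ⊆-antisym)
open import Data.Integer as ℤ using (-[1+_]; 0ℤ; 1ℤ; -1ℤ; -_; +≤+)
  renaming (_+_ to _+ℤ_; _*_ to _*ℤ_; _≤_ to _≤ℤ_)
import Data.Integer.Properties as ℤ
open import Data.Integer.Solver using (module +-*-Solver)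
open import Data.List using (length)
open import Data.List.Relation.Unary.Any using (here; there)
open import Data.Nat using (z≤n; s≤s; _+_; _<_; pred)
import Data.Nat.Properties as ℕ
import Data.Nat.Solver as ℕ-Solver
open import Data.Product using (proj₁; proj₂)
import Data.Product
open import Data.Sum using (inj₁; inj₂; [_,_])
import Data.Sum
open import Data.Unit using (tt)
open import Data.Vec using ([]; _∷_; lookup)
import Data.Vec.Properties as Vec
open import Data.Vec.Relation.Binary.Pointwise.Extensional using (ext; Pointwise-≡⇒≡)
open import Function using (_∘_; id; flip)
open import Function.Bundles using (mk⇔; module Equivalence)
open Equivalence using (to; from)
open import Level using (0ℓ)
open import Relation.Binary.PropositionalEquality
  using (_≢_; refl; sym; trans; cong; cong₂; subst; subst₂; module ≡-Reasoning)
open import Relation.Nullary using (¬_; Dec; yes; no; ¬?)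
open import Relation.Nullary.Decidable using (_×-dec_)
open import Relation.Unary using (Pred; Decidable)
open import Relation.Unary.Properties using (_∩?_)

open import Algebra.Properties.CommutativeSemigroup ℤ.+-commutativeSemigroup
  using () renaming (interchange to +-interchange)
open import Algebra.Properties.CommutativeSemigroup ℕ.+-commutativeSemigroup
  using () renaming (interchange to +-interchangeℕ)
open import Algebra.Properties.CommutativeMonoid.Sum ℕ.+-0-commutativeMonoid
  using (sum; sum-cong-≗; sum-permute)

-- Finite sums and linear combinations

∑ : ∀ {m} → (Fin m → ℤ) → ℤ
∑ {zero}  f = 0ℤ
∑ {suc m} f = f zero +ℤ ∑ (f ∘ suc)

∑-cong : ∀ {m} {f g : Fin m → ℤ} → (∀ j → f j ≡ g j) → ∑ f ≡ ∑ g
∑-cong {zero}  e = refl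
∑-cong {suc m} e = cong₂ _+ℤ_ (e zero) (∑-cong (e ∘ suc))

∑-zero : ∀ {m} {f : Fin m → ℤ} → (∀ j → f j ≡ 0ℤ) → ∑ f ≡ 0ℤ
∑-zero {zero}  e = refl
∑-zero {suc m} e = cong₂ _+ℤ_ (e zero) (∑-zero (e ∘ suc))

∑-+ : ∀ {m} (f g : Fin m → ℤ) → ∑ (λ j → f j +ℤ g j) ≡ ∑ f +ℤ ∑ g
∑-+ {zero}  f g = refl
∑-+ {suc m} f g = trans (cong ((f zero +ℤ g zero) +ℤ_) (∑-+ (f ∘ suc) (g ∘ suc)))
                        (+-interchange (f zero) (g zero) (∑ (f ∘ suc)) (∑ (g ∘ suc)))

∑-*ˡ : ∀ {m} z (f : Fin m → ℤ) → ∑ (λ j → z *ℤ f j) ≡ z *ℤ ∑ f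
∑-*ˡ {zero}  z f = sym (ℤ.*-zeroʳ z)
∑-*ˡ {suc m} z f = trans (cong (z *ℤ f zero +ℤ_) (∑-*ˡ z (f ∘ suc)))
                         (sym (ℤ.*-distribˡ-+ z (f zero) (∑ (f ∘ suc))))

∑-*ʳ : ∀ {m} z (f : Fin m → ℤ) → ∑ (λ j → f j *ℤ z) ≡ ∑ f *ℤ z
∑-*ʳ z f = trans (∑-cong (λ j → ℤ.*-comm (f j) z)) (trans (∑-*ˡ z f) (ℤ.*-comm z (∑ f)))

∑-comm : ∀ {m k} (f : Fin m → Fin k → ℤ) → ∑ (λ i → ∑ (f i)) ≡ ∑ (λ j → ∑ (λ i → f i j))
∑-comm {zero} {k} f = sym (∑-zero {k} (λ _ → refl))
∑-comm {suc m} f = trans (cong (∑ (f zero) +ℤ_) (∑-comm (f ∘ suc)))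
                         (sym (∑-+ (f zero) (λ j → ∑ (λ i → f (suc i) j))))

nonneg-* : ∀ {a b} → 0ℤ ≤ℤ a → 0ℤ ≤ℤ b → 0ℤ ≤ℤ a *ℤ b
nonneg-* {ℤ.+ x} {ℤ.+ y} _ _ = subst (0ℤ ≤ℤ_) (ℤ.pos-* x y) (+≤+ z≤n)

∑-nonneg : ∀ {m} {f : Fin m → ℤ} → (∀ j → 0ℤ ≤ℤ f j) → 0ℤ ≤ℤ ∑ f
∑-nonneg {zero}  h = +≤+ z≤n
∑-nonneg {suc m} h = ℤ.+-mono-≤ (h zero) (∑-nonneg (h ∘ suc))

∑-nonpos : ∀ {m} {f : Fin m → ℤ} → (∀ j → f j ≤ℤ 0ℤ) → ∑ f ≤ℤ 0ℤ
∑-nonpos {zero}  h = +≤+ z≤n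
∑-nonpos {suc m} h = ℤ.+-mono-≤ (h zero) (∑-nonpos (h ∘ suc))

∑-nonneg-≡0 : ∀ {m} {f : Fin m → ℤ} → (∀ j → 0ℤ ≤ℤ f j) → ∑ f ≡ 0ℤ → ∀ j → f j ≡ 0ℤ
∑-nonneg-≡0 {suc m} {f} h e j = go j
  where
  nonneg-+-≡0 : ∀ {a b} → 0ℤ ≤ℤ a → 0ℤ ≤ℤ b → a +ℤ b ≡ 0ℤ → a ≡ 0ℤ
  nonneg-+-≡0 {ℤ.+ zero} _ _ _ = refl
  nonneg-+-≡0 {ℤ.+ suc _} {ℤ.+ _} _ _ ()
  head≡0 : f zero ≡ 0ℤ
  head≡0 = nonneg-+-≡0 (h zero) (∑-nonneg (h ∘ suc)) e
  go : ∀ j → f j ≡ 0ℤ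
  go zero    = head≡0
  go (suc j) = ∑-nonneg-≡0 (h ∘ suc) tail≡0 j
    where
    tail≡0 : ∑ (f ∘ suc) ≡ 0ℤ
    tail≡0 = trans (sym (ℤ.+-identityˡ _)) (trans (sym (cong (_+ℤ ∑ (f ∘ suc)) head≡0)) e)

∑≢0⇒∃≢0 : ∀ {m} (f : Fin m → ℤ) → ∑ f ≢ 0ℤ → ∃ λ j → f j ≢ 0ℤ
∑≢0⇒∃≢0 {zero}  f ne = ⊥-elim (ne refl)
∑≢0⇒∃≢0 {suc m} f ne with f zero ℤ.≟ 0ℤ
... | no f0≢0 = zero , f0≢0
... | yes f0≡0 with ∑≢0⇒∃≢0 (f ∘ suc) (λ e → ne (cong₂ _+ℤ_ f0≡0 e))
...   | j , fj≢0 = suc j , fj≢0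

δ : ∀ {m} → Fin m → Fin m → ℤ
δ zero    zero    = 1ℤ
δ zero    (suc j) = 0ℤ
δ (suc k) zero    = 0ℤ
δ (suc k) (suc j) = δ k j

δ-self : ∀ {m} (k : Fin m) → δ k k ≡ 1ℤ
δ-self zero    = refl
δ-self (suc k) = δ-self k

δ-≢ : ∀ {m} {k j : Fin m} → k ≢ j → δ k j ≡ 0ℤ
δ-≢ {k = zero}  {zero}  k≢j = ⊥-elim (k≢j refl)
δ-≢ {k = zero}  {suc j} k≢j = refl
δ-≢ {k = suc k} {zero}  k≢j = refl
δ-≢ {k = suc k} {suc j} k≢j = δ-≢ (k≢j ∘ cong suc)

δ-nonneg : ∀ {m} (k j : Fin m) → 0ℤ ≤ℤ δ k j
δ-nonneg zero    zero    = +≤+ z≤n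
δ-nonneg zero    (suc j) = +≤+ z≤n
δ-nonneg (suc k) zero    = +≤+ z≤n
δ-nonneg (suc k) (suc j) = δ-nonneg k j

∑-δ : ∀ {m} (k : Fin m) (f : Fin m → ℤ) → ∑ (λ j → δ k j *ℤ f j) ≡ f k
∑-δ {suc m} zero f =
  trans (cong₂ _+ℤ_ (ℤ.*-identityˡ (f zero)) (∑-zero {m} (λ _ → refl))) (ℤ.+-identityʳ (f zero))
∑-δ (suc k) f   = trans (ℤ.+-identityˡ _) (∑-δ k (f ∘ suc))

nonneg-factor-δ : ∀ {m k} {a : Fin k → ℤ} {b : Fin k → Fin m → ℤ} {j : Fin m} →
                  (∀ l → 0ℤ ≤ℤ a l) → (∀ l s → 0ℤ ≤ℤ b l s) →
                  (∀ s → ∑ (λ l → a l *ℤ b l s) ≡ δ j s) →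
                  ∃ λ l → a l ≢ 0ℤ × (∀ s → b l s ≡ b l j *ℤ δ j s)
nonneg-factor-δ {k = k} {a} {b} {j} a≥0 b≥0 ∑ab≡δ = l , al≢0 , concentrated
  where
  witness : ∃ λ l → a l *ℤ b l j ≢ 0ℤ
  witness = ∑≢0⇒∃≢0 _ λ ∑≡0 → 1≢0 (trans (sym (δ-self j)) (trans (sym (∑ab≡δ j)) ∑≡0))
    where
    1≢0 : 1ℤ ≢ 0ℤ
    1≢0 ()
  l : Fin k
  l = proj₁ witness
  al≢0 : a l ≢ 0ℤ
  al≢0 al≡0 = proj₂ witness (trans (cong (_*ℤ b l j) al≡0) (ℤ.*-zeroˡ (b l j)))
  concentrated : ∀ s → b l s ≡ b l j *ℤ δ j s
  concentrated s with j ≟ s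
  ... | yes refl = trans (sym (ℤ.*-identityʳ (b l j))) (cong (b l j *ℤ_) (sym (δ-self j)))
  ... | no  j≢s  = trans bls≡0 (trans (sym (ℤ.*-zeroʳ (b l j))) (cong (b l j *ℤ_) (sym (δ-≢ j≢s))))
    where
    bls≡0 : b l s ≡ 0ℤ
    bls≡0 with ℤ.i*j≡0⇒i≡0∨j≡0 (a l)
                 (∑-nonneg-≡0 (λ l' → nonneg-* (a≥0 l') (b≥0 l' s)) (trans (∑ab≡δ s) (δ-≢ j≢s)) l)
    ... | inj₁ al≡0  = ⊥-elim (al≢0 al≡0)
    ... | inj₂ bls≡0 = bls≡0

lookup-ext : ∀ {n} {u v : Vec ℤ n} → (∀ p → lookup u p ≡ lookup v p) → u ≡ v
lookup-ext h = Pointwise-≡⇒≡ (ext h)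

lookup-+ᵥ : ∀ {n} (u v : Vec ℤ n) p → lookup (u +ᵥ v) p ≡ lookup u p +ℤ lookup v p
lookup-+ᵥ u v p = Vec.lookup-zipWith _+ℤ_ p u v

lookup-·ᵥ : ∀ {n} z (v : Vec ℤ n) p → lookup (z ·ᵥ v) p ≡ z *ℤ lookup v p
lookup-·ᵥ z v p = Vec.lookup-map p (z *ℤ_) v

lookup-0ᵥ : ∀ {n} p → lookup (0ᵥ {n}) p ≡ 0ℤ
lookup-0ᵥ {n} p = Vec.lookup-replicate p 0ℤ

-ᵥ-involutive : ∀ {n} (v : Vec ℤ n) → -ᵥ (-ᵥ v) ≡ v
-ᵥ-involutive v = trans (sym (Vec.map-∘ -_ -_ v)) (trans (Vec.map-cong ℤ.neg-involutive v) (Vec.map-id v))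

·ᵥ-identityˡ : ∀ {n} (v : Vec ℤ n) → 1ℤ ·ᵥ v ≡ v
·ᵥ-identityˡ v = trans (Vec.map-cong ℤ.*-identityˡ v) (Vec.map-id v)

-1·ᵥ : ∀ {n} (v : Vec ℤ n) → -1ℤ ·ᵥ v ≡ -ᵥ v
-1·ᵥ v = Vec.map-cong ℤ.-1*i≡-i v

0·ᵥ : ∀ {n} (v : Vec ℤ n) → 0ℤ ·ᵥ v ≡ 0ᵥ
0·ᵥ v = lookup-ext λ p → trans (lookup-·ᵥ 0ℤ v p) (sym (lookup-0ᵥ p))

·ᵥ-assoc : ∀ {n} z w (v : Vec ℤ n) → z ·ᵥ (w ·ᵥ v) ≡ (z *ℤ w) ·ᵥ v
·ᵥ-assoc z w v = trans (sym (Vec.map-∘ (z *ℤ_) (w *ℤ_) v)) (Vec.map-cong (λ x → sym (ℤ.*-assoc z w x)) v)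

lookup-comb : ∀ {n m} (R : Vec (Vec ℤ n) m) c p →
              lookup (comb R c) p ≡ ∑ (λ j → c j *ℤ lookup (lookup R j) p)
lookup-comb []      c p = lookup-0ᵥ p
lookup-comb (x ∷ R) c p = trans (lookup-+ᵥ (c zero ·ᵥ x) (comb R (c ∘ suc)) p)
                                (cong₂ _+ℤ_ (lookup-·ᵥ (c zero) x p) (lookup-comb R (c ∘ suc) p))

module _ {n m : ℕ} (R : Vec (Vec ℤ n) m) where

  comb-cong : ∀ {c c' : Fin m → ℤ} → (∀ j → c j ≡ c' j) → comb R c ≡ comb R c'
  comb-cong {c} {c'} e = lookup-ext λ p → begin
    lookup (comb R c) p                       ≡⟨ lookup-comb R c p ⟩
    ∑ (λ j → c j *ℤ lookup (lookup R j) p)    ≡⟨ ∑-cong (λ j → cong (_*ℤ _) (e j)) ⟩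
    ∑ (λ j → c' j *ℤ lookup (lookup R j) p)   ≡⟨ lookup-comb R c' p ⟨
    lookup (comb R c') p                      ∎
    where open ≡-Reasoning

  comb-δ : ∀ k → comb R (δ k) ≡ lookup R k
  comb-δ k = lookup-ext λ p → trans (lookup-comb R (δ k) p) (∑-δ k (λ j → lookup (lookup R j) p))

  comb-zero : comb R (λ _ → 0ℤ) ≡ 0ᵥ
  comb-zero = lookup-ext λ p → trans (lookup-comb R _ p) (trans (∑-zero {m} (λ _ → refl)) (sym (lookup-0ᵥ p)))

  comb-scale : ∀ z c → comb R (λ j → z *ℤ c j) ≡ z ·ᵥ comb R c
  comb-scale z c = lookup-ext λ p → begin
    lookup (comb R (λ j → z *ℤ c j)) p              ≡⟨ lookup-comb R _ p ⟩
    ∑ (λ j → z *ℤ c j *ℤ lookup (lookup R j) p)     ≡⟨ ∑-cong (λ j → ℤ.*-assoc z (c j) _) ⟩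
    ∑ (λ j → z *ℤ (c j *ℤ lookup (lookup R j) p))   ≡⟨ ∑-*ˡ z (λ j → c j *ℤ lookup (lookup R j) p) ⟩
    z *ℤ ∑ (λ j → c j *ℤ lookup (lookup R j) p)     ≡⟨ cong (z *ℤ_) (lookup-comb R c p) ⟨
    z *ℤ lookup (comb R c) p                        ≡⟨ lookup-·ᵥ z (comb R c) p ⟨
    lookup (z ·ᵥ comb R c) p                        ∎
    where open ≡-Reasoning

  comb-neg : ∀ c → comb R (λ j → - c j) ≡ -ᵥ comb R c
  comb-neg c = begin
    comb R (λ j → - c j)        ≡⟨ comb-cong (λ j → sym (ℤ.-1*i≡-i (c j))) ⟩
    comb R (λ j → -1ℤ *ℤ c j)   ≡⟨ comb-scale -1ℤ c ⟩
    -1ℤ ·ᵥ comb R c             ≡⟨ -1·ᵥ (comb R c) ⟩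
    -ᵥ comb R c                 ∎
    where open ≡-Reasoning

  comb-subst : ∀ (c : Fin m → ℤ) (d : Fin m → Fin m → ℤ) →
               (∀ l → c l ≡ 0ℤ ⊎ comb R (d l) ≡ lookup R l) →
               comb R (λ s → ∑ (λ l → c l *ℤ d l s)) ≡ comb R c
  comb-subst c d h = lookup-ext λ p → begin
    lookup (comb R (λ s → ∑ (λ l → c l *ℤ d l s))) p
      ≡⟨ lookup-comb R _ p ⟩
    ∑ (λ s → ∑ (λ l → c l *ℤ d l s) *ℤ r s p)
      ≡⟨ ∑-cong (λ s → sym (∑-*ʳ (r s p) (λ l → c l *ℤ d l s))) ⟩
    ∑ (λ s → ∑ (λ l → c l *ℤ d l s *ℤ r s p))
      ≡⟨ ∑-comm (λ s l → c l *ℤ d l s *ℤ r s p) ⟩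
    ∑ (λ l → ∑ (λ s → c l *ℤ d l s *ℤ r s p))
      ≡⟨ ∑-cong (λ l → trans (∑-cong (λ s → ℤ.*-assoc (c l) (d l s) _))
                             (∑-*ˡ (c l) (λ s → d l s *ℤ r s p))) ⟩
    ∑ (λ l → c l *ℤ ∑ (λ s → d l s *ℤ r s p))
      ≡⟨ ∑-cong (λ l → expand l (h l)) ⟩
    ∑ (λ l → c l *ℤ r l p)
      ≡⟨ lookup-comb R c p ⟨
    lookup (comb R c) p ∎
    where
    open ≡-Reasoning
    r : Fin m → Fin n → ℤ
    r s p = lookup (lookup R s) p
    expand : ∀ {p} l → c l ≡ 0ℤ ⊎ comb R (d l) ≡ lookup R l →
             c l *ℤ ∑ (λ s → d l s *ℤ r s p) ≡ c l *ℤ r l p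
    expand l (inj₁ cl≡0) rewrite cl≡0 = refl
    expand {p} l (inj₂ dl) = cong (c l *ℤ_) (trans (sym (lookup-comb R (d l) p)) (cong (λ v → lookup v p) dl))

comb-single-support : ∀ {n m} (R : Vec (Vec ℤ n) m) {S c j} → (∀ {l} → l ∈ S → l ≡ j) → Supp R c S →
                      comb R c ≡ c j ·ᵥ lookup R j
comb-single-support R {S} {c} {j} S⊆j c-supp =
  trans (comb-cong R c≡) (trans (comb-scale R (c j) (δ j)) (cong (c j ·ᵥ_) (comb-δ R j)))
  where
  c≡ : ∀ l → c l ≡ c j *ℤ δ j l
  c≡ l with j ≟ l
  ... | yes refl = trans (sym (ℤ.*-identityʳ (c l))) (cong (c l *ℤ_) (sym (δ-self l)))
  ... | no  j≢l  = trans (c-supp l λ l∈S → j≢l (sym (S⊆j l∈S)))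
                         (trans (sym (ℤ.*-zeroʳ (c j))) (cong (c j *ℤ_) (sym (δ-≢ j≢l))))

-- Counting

indicator : ∀ {A : Set} → Dec A → ℕ
indicator (yes _) = 1
indicator (no  _) = 0

indicator-≡ : ∀ {A B : Set} (a : Dec A) (b : Dec B) → (A → B) → (B → A) → indicator a ≡ indicator b
indicator-≡ (yes _) (yes _) _   _   = refl
indicator-≡ (no  _) (no  _) _   _   = refl
indicator-≡ (yes a) (no ¬b) A→B _   = ⊥-elim (¬b (A→B a))
indicator-≡ (no ¬a) (yes b) _   B→A = ⊥-elim (¬a (B→A b))

count : ∀ {m} {P : Pred (Fin m) 0ℓ} → Decidable P → ℕ
count P? = sum (λ j → indicator (P? j))

module _ {m : ℕ} {P Q : Pred (Fin m) 0ℓ} (P? : Decidable P) (Q? : Decidable Q) where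

  count-cong : (∀ j → P j → Q j) → (∀ j → Q j → P j) → count P? ≡ count Q?
  count-cong P⊆Q Q⊆P = sum-cong-≗ λ j → indicator-≡ (P? j) (Q? j) (P⊆Q j) (Q⊆P j)

  count-involution : (σ : Fin m → Fin m) → (∀ j → σ (σ j) ≡ j) →
                     (∀ j → P j → Q (σ j)) → (∀ j → Q (σ j) → P j) → count P? ≡ count Q?
  count-involution σ σσ P⇒Qσ Qσ⇒P =
    trans (sum-cong-≗ λ j → indicator-≡ (P? j) (Q? (σ j)) (P⇒Qσ j) (Qσ⇒P j))
          (sym (sum-permute (λ j → indicator (Q? j)) (permutation σ σ σσ σσ)))

count-split : ∀ {m} {A B C : Pred (Fin m) 0ℓ} (A? : Decidable A) (B? : Decidable B) (C? : Decidable C) →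
              (∀ j → A j → B j ⊎ C j) → (∀ j → B j → A j) → (∀ j → C j → A j) →
              (∀ j → B j → ¬ C j) →
              count A? ≡ count B? + count C?
count-split {zero}  _ _ _ _ _ _ _ = refl
count-split {suc m} {A} {B} {C} A? B? C? A⇒B⊎C B⇒A C⇒A B⇒¬C = begin
  indicator (A? zero) + count (A? ∘ suc)
    ≡⟨ cong₂ _+_ (head (A? zero) (B? zero) (C? zero))
                 (count-split (A? ∘ suc) (B? ∘ suc) (C? ∘ suc)
                              (A⇒B⊎C ∘ suc) (B⇒A ∘ suc) (C⇒A ∘ suc) (B⇒¬C ∘ suc)) ⟩
  (indicator (B? zero) + indicator (C? zero)) + (count (B? ∘ suc) + count (C? ∘ suc))
    ≡⟨ +-interchangeℕ (indicator (B? zero)) _ _ _ ⟩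
  (indicator (B? zero) + count (B? ∘ suc)) + (indicator (C? zero) + count (C? ∘ suc)) ∎
  where
  open ≡-Reasoning
  head : (a : Dec (A zero)) (b : Dec (B zero)) (c : Dec (C zero)) → indicator a ≡ indicator b + indicator c
  head _       (yes b) (yes c) = ⊥-elim (B⇒¬C zero b c)
  head (yes _) (yes _) (no  _) = refl
  head (yes _) (no  _) (yes _) = refl
  head (yes a) (no ¬b) (no ¬c) with A⇒B⊎C zero a
  ... | inj₁ b = ⊥-elim (¬b b)
  ... | inj₂ c = ⊥-elim (¬c c)
  head (no ¬a) (yes b) _       = ⊥-elim (¬a (B⇒A zero b))
  head (no ¬a) (no  _) (yes c) = ⊥-elim (¬a (C⇒A zero c))
  head (no  _) (no  _) (no  _) = refl

count-∅ : ∀ {m} {P : Pred (Fin m) 0ℓ} (P? : Decidable P) → (∀ j → ¬ P j) → count P? ≡ 0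
count-∅ {zero}  P? ¬P = refl
count-∅ {suc m} P? ¬P with P? zero
... | yes p = ⊥-elim (¬P zero p)
... | no  _ = count-∅ (P? ∘ suc) (¬P ∘ suc)

count-all : ∀ {m} {P : Pred (Fin m) 0ℓ} (P? : Decidable P) → (∀ j → P j) → count P? ≡ m
count-all {zero}  P? allP = refl
count-all {suc m} P? allP with P? zero
... | yes _ = cong suc (count-all (P? ∘ suc) (allP ∘ suc))
... | no ¬p = ⊥-elim (¬p (allP zero))

count-singleton : ∀ {m} {P : Pred (Fin m) 0ℓ} (P? : Decidable P) (a : Fin m) →
                  (∀ j → P j → j ≡ a) → P a → count P? ≡ 1
count-singleton {suc m} P? zero P⇒≡ Pa with P? zero
... | yes _ = cong suc (count-∅ (P? ∘ suc) λ j Pj → case (P⇒≡ (suc j) Pj))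
  where case : ∀ {j : Fin m} → suc j ≢ zero
        case ()
... | no ¬p = ⊥-elim (¬p Pa)
count-singleton {suc m} P? (suc a) P⇒≡ Pa with P? zero
... | yes p = ⊥-elim (case (P⇒≡ zero p))
  where case : zero ≢ suc a
        case ()
... | no _ = count-singleton (P? ∘ suc) a (λ j Pj → Fin.suc-injective (P⇒≡ (suc j) Pj)) Pa

count≡0⇒∅ : ∀ {m} {P : Pred (Fin m) 0ℓ} (P? : Decidable P) → count P? ≡ 0 → ∀ j → ¬ P j
count≡0⇒∅ {suc m} P? c≡0 j Pj with P? zero
count≡0⇒∅ {suc m} P? () zero Pj | yes _
count≡0⇒∅ {suc m} P? () (suc j) Pj | yes _
count≡0⇒∅ {suc m} P? c≡0 zero Pj | no ¬p = ¬p Pj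
count≡0⇒∅ {suc m} P? c≡0 (suc j) Pj | no _ = count≡0⇒∅ (P? ∘ suc) c≡0 j Pj

module _ {m : ℕ} {P Q : Pred (Fin m) 0ℓ} (P? : Decidable P) (Q? : Decidable Q) where

  count-insert : ∀ a → (∀ j → Q j → P j ⊎ j ≡ a) → (∀ j → P j → Q j) → Q a → ¬ P a →
                 count Q? ≡ suc (count P?)
  count-insert a Q⇒P⊎a P⇒Q Qa ¬Pa = begin
    count Q?
      ≡⟨ count-split Q? P? (_≟ a) Q⇒P⊎a P⇒Q (λ { j refl → Qa }) (λ { j Pj refl → ¬Pa Pj }) ⟩
    count P? + count (_≟ a)         ≡⟨ cong (λ x → count P? + x) (count-singleton (_≟ a) a (λ _ → id) refl) ⟩
    count P? + 1                    ≡⟨ ℕ.+-comm (count P?) 1 ⟩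
    suc (count P?)                  ∎
    where open ≡-Reasoning

  count-⊆-≡⇒⊇ : (∀ j → P j → Q j) → count P? ≡ count Q? → ∀ j → Q j → P j
  count-⊆-≡⇒⊇ P⇒Q P≡Q j Qj with P? j
  ... | yes Pj = Pj
  ... | no ¬Pj = ⊥-elim (count≡0⇒∅ Q∖P? Q∖P≡0 j (Qj , ¬Pj))
    where
    Q∖P? : Decidable (λ j → Q j × ¬ P j)
    Q∖P? j = Q? j ×-dec ¬? (P? j)
    Q∖P≡0 : count Q∖P? ≡ 0
    Q∖P≡0 = ℕ.+-cancelˡ-≡ (count P?) _ 0 (sym (begin
      count P? + 0               ≡⟨ ℕ.+-identityʳ (count P?) ⟩
      count P?                   ≡⟨ P≡Q ⟩
      count Q?                   ≡⟨ count-split Q? P? Q∖P? split P⇒Q (λ _ → proj₁) (λ _ Pj → flip proj₂ Pj) ⟩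
      count P? + count Q∖P?      ∎))
      where
      open ≡-Reasoning
      split : ∀ j → Q j → P j ⊎ (Q j × ¬ P j)
      split j Qj with P? j
      ... | yes Pj = inj₁ Pj
      ... | no ¬Pj = inj₂ (Qj , ¬Pj)

-- Positive and negative cones

-- Pos and Neg are the cones for P = (0 ≤_) and P = (_≤ 0).
Cone : ∀ {n m} → Vec (Vec ℤ n) m → (ℤ → Set) → Subset m → Fin m → Set
Cone {m = m} R P S j = ∃ λ c → Supp R c S × (∀ (l : Fin m) → P (c l)) × comb R c ≡ lookup R j

δ-supp : ∀ {n m} (R : Vec (Vec ℤ n) m) {S j} → j ∈ S → Supp R (δ j) S
δ-supp R {S} j∈S l l∉S = δ-≢ λ j≡l → l∉S (subst (_∈ S) j≡l j∈S)

∈⇒Pos : ∀ {n m} (R : Vec (Vec ℤ n) m) {S j} → j ∈ S → Pos R S j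
∈⇒Pos R {j = j} j∈S = δ j , δ-supp R j∈S , δ-nonneg j , comb-δ R j

module Expansion {n m : ℕ} (R : Vec (Vec ℤ n) m) {S T : Subset m} (P : ℤ → Set) (P0 : P 0ℤ)
                 (T⊆S : ∀ l → l ∈ T → Cone R P S l) where

  expansion : Fin m → Fin m → ℤ
  expansion l with l ∈? T
  ... | yes l∈T = proj₁ (T⊆S l l∈T)
  ... | no  _   = λ _ → 0ℤ

  expansion-supp : ∀ l → Supp R (expansion l) S
  expansion-supp l with l ∈? T
  ... | yes l∈T = proj₁ (proj₂ (T⊆S l l∈T))
  ... | no  _   = λ _ _ → refl

  expansion-sign : ∀ l s → P (expansion l s)
  expansion-sign l with l ∈? T
  ... | yes l∈T = proj₁ (proj₂ (proj₂ (T⊆S l l∈T)))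
  ... | no  _   = λ _ → P0

  expansion-comb : ∀ l → l ∈ T → comb R (expansion l) ≡ lookup R l
  expansion-comb l l∈T with l ∈? T
  ... | yes l∈T' = proj₂ (proj₂ (proj₂ (T⊆S l l∈T')))
  ... | no  l∉T  = ⊥-elim (l∉T l∈T)

  substitute : (Fin m → ℤ) → Fin m → ℤ
  substitute c s = ∑ (λ l → c l *ℤ expansion l s)

  substitute-supp : ∀ c → Supp R (substitute c) S
  substitute-supp c s s∉S = ∑-zero λ l → trans (cong (c l *ℤ_) (expansion-supp l s s∉S)) (ℤ.*-zeroʳ (c l))

  substitute-comb : ∀ c → Supp R c T → comb R (substitute c) ≡ comb R c
  substitute-comb c c-supp = comb-subst R c expansion term
    where
    by-membership : ∀ l → Dec (l ∈ T) → c l ≡ 0ℤ ⊎ comb R (expansion l) ≡ lookup R l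
    by-membership l (yes l∈T) = inj₂ (expansion-comb l l∈T)
    by-membership l (no  l∉T) = inj₁ (c-supp l l∉T)
    term : ∀ l → c l ≡ 0ℤ ⊎ comb R (expansion l) ≡ lookup R l
    term l = by-membership l (l ∈? T)

  Cone-trans : ∀ (Q P' : ℤ → Set) → (∀ {a b} → Q a → P b → P' (a *ℤ b)) →
               (∀ {f : Fin m → ℤ} → (∀ l → P' (f l)) → P' (∑ f)) →
               ∀ j → Cone R Q T j → Cone R P' S j
  Cone-trans _ _ mul sum-closed j (c , c-supp , c-sign , c-comb) =
    substitute c , substitute-supp c ,
    (λ s → sum-closed (λ l → mul (c-sign l) (expansion-sign l s))) ,
    trans (substitute-comb c c-supp) c-comb

NonNeg NonPos : ℤ → Set
NonNeg x = 0ℤ ≤ℤ x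
NonPos x = x ≤ℤ 0ℤ

nonneg-*-nonpos : ∀ {a b} → 0ℤ ≤ℤ a → b ≤ℤ 0ℤ → a *ℤ b ≤ℤ 0ℤ
nonneg-*-nonpos {a} {b} 0≤a b≤0 =
  subst (_≤ℤ 0ℤ) (trans (ℤ.neg-distribʳ-* a (- b)) (cong (a *ℤ_) (ℤ.neg-involutive b)))
        (ℤ.neg-mono-≤ (nonneg-* 0≤a (ℤ.neg-mono-≤ b≤0)))

module _ {n m : ℕ} (R : Vec (Vec ℤ n) m) {S T : Subset m} where

  Pos-trans : (∀ l → l ∈ T → Pos R S l) → ∀ j → Pos R T j → Pos R S j
  Pos-trans T⊆S = Expansion.Cone-trans R NonNeg (+≤+ z≤n) T⊆S NonNeg NonNeg nonneg-* ∑-nonneg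

  Neg-trans : (∀ l → l ∈ T → Neg R S l) → ∀ j → Pos R T j → Neg R S j
  Neg-trans T⊆S = Expansion.Cone-trans R NonPos (+≤+ z≤n) T⊆S NonNeg NonPos nonneg-*-nonpos ∑-nonpos

-- Bases of a reduced root system

module RootSystem {n m : ℕ} (R : Vec (Vec ℤ n) m) (dist : Distinct R) (red : Reduced R) where

  neg : Fin m → Fin m
  neg j = proj₁ (proj₁ red j)

  lookup-neg : ∀ j → lookup R (neg j) ≡ -ᵥ lookup R j
  lookup-neg j = proj₂ (proj₁ red j)

  neg-involutive : ∀ j → neg (neg j) ≡ j
  neg-involutive j = dist _ _ (trans (lookup-neg (neg j)) (trans (cong -ᵥ_ (lookup-neg j)) (-ᵥ-involutive _)))

  root≢0 : ∀ j → lookup R j ≢ 0ᵥ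
  root≢0 j R_j≡0 with proj₂ red j j 0ℤ (trans R_j≡0 (sym (0·ᵥ (lookup R j))))
  ... | inj₁ ()
  ... | inj₂ ()

  nonneg-multiple⇒≡ : ∀ {l j z} → lookup R l ≡ z ·ᵥ lookup R j → 0ℤ ≤ℤ z → l ≡ j
  nonneg-multiple⇒≡ {l} {j} {z} R_l≡zR_j 0≤z with proj₂ red j l z R_l≡zR_j
  ... | inj₁ refl = dist l j (trans R_l≡zR_j (·ᵥ-identityˡ (lookup R j)))
  ... | inj₂ refl with 0≤z
  ...   | ()

  module _ {S : Subset m} (bS : 𝔹 R S) where

    Pos⇒¬Neg : ∀ {j} → Pos R S j → ¬ Neg R S j
    Pos⇒¬Neg {j} (c , c-supp , c-sign , c-comb) (c' , c'-supp , c'-sign , c'-comb) =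
      root≢0 j (trans (sym c-comb) (trans (comb-cong R c≡0) (comb-zero R)))
      where
      c≡c' : ∀ l → c l ≡ c' l
      c≡c' = proj₂ (proj₁ bS) c c' c-supp c'-supp (trans c-comb (sym c'-comb))
      c≡0 : ∀ l → c l ≡ 0ℤ
      c≡0 l = ℤ.≤-antisym (subst (_≤ℤ 0ℤ) (sym (c≡c' l)) (c'-sign l)) (c-sign l)

    Pos⇒Neg-neg : ∀ {j} → Pos R S j → Neg R S (neg j)
    Pos⇒Neg-neg {j} (c , c-supp , c-sign , c-comb) =
      (λ l → - c l) , (λ l l∉S → cong -_ (c-supp l l∉S)) , (λ l → ℤ.neg-mono-≤ (c-sign l)) ,
      trans (comb-neg R c) (trans (cong -ᵥ_ c-comb) (sym (lookup-neg j)))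

    Neg⇒Pos-neg : ∀ {j} → Neg R S j → Pos R S (neg j)
    Neg⇒Pos-neg {j} (c , c-supp , c-sign , c-comb) =
      (λ l → - c l) , (λ l l∉S → cong -_ (c-supp l l∉S)) , (λ l → ℤ.neg-mono-≤ (c-sign l)) ,
      trans (comb-neg R c) (trans (cong -ᵥ_ c-comb) (sym (lookup-neg j)))

    Pos-neg⇒Neg : ∀ {j} → Pos R S (neg j) → Neg R S j
    Pos-neg⇒Neg {j} p = subst (Neg R S) (neg-involutive j) (Pos⇒Neg-neg p)

    Neg-neg⇒Pos : ∀ {j} → Neg R S (neg j) → Pos R S j
    Neg-neg⇒Pos {j} q = subst (Pos R S) (neg-involutive j) (Neg⇒Pos-neg q)

    ¬Neg⇒Pos : ∀ {j} → ¬ Neg R S j → Pos R S j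
    ¬Neg⇒Pos {j} ¬q with proj₂ bS j
    ... | inj₁ p = p
    ... | inj₂ q = ⊥-elim (¬q q)

    Pos? : ∀ j → Dec (Pos R S j)
    Pos? j with proj₂ bS j
    ... | inj₁ p = yes p
    ... | inj₂ q = no λ p → Pos⇒¬Neg p q

    Neg? : ∀ j → Dec (Neg R S j)
    Neg? j with proj₂ bS j
    ... | inj₁ p = no (Pos⇒¬Neg p)
    ... | inj₂ q = yes q

  -- A basis vector of S is not a nonnegative combination of other roots positive for S.
  simple-root-∈ : ∀ {S T} → 𝔹 R S → (∀ l → l ∈ T → Pos R S l) →
                  ∀ {j} → j ∈ S → Pos R T j → j ∈ T
  simple-root-∈ {S} {T} bS T⊆S {j} j∈S (c , c-supp , c-sign , c-comb) = subst (_∈ T) l≡j l∈T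
    where
    open Expansion R NonNeg (+≤+ z≤n) T⊆S
    factor : ∃ λ l → c l ≢ 0ℤ × (∀ s → expansion l s ≡ expansion l j *ℤ δ j s)
    factor = nonneg-factor-δ c-sign expansion-sign
               (proj₂ (proj₁ bS) (substitute c) (δ j) (substitute-supp c) (δ-supp R j∈S)
                  (trans (substitute-comb c c-supp) (trans c-comb (sym (comb-δ R j)))))
    l : Fin m
    l = proj₁ factor
    l∈T : l ∈ T
    l∈T with l ∈? T
    ... | yes l∈T = l∈T
    ... | no  l∉T = ⊥-elim (proj₁ (proj₂ factor) (c-supp l l∉T))
    z : ℤ
    z = expansion l j
    l≡j : l ≡ j
    l≡j = nonneg-multiple⇒≡ (begin
      lookup R l                     ≡⟨ expansion-comb l l∈T ⟨
      comb R (expansion l)           ≡⟨ comb-cong R (proj₂ (proj₂ factor)) ⟩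
      comb R (λ s → z *ℤ δ j s)      ≡⟨ comb-scale R z (δ j) ⟩
      z ·ᵥ comb R (δ j)              ≡⟨ cong (z ·ᵥ_) (comb-δ R j) ⟩
      z ·ᵥ lookup R j                ∎) (expansion-sign l j)
      where open ≡-Reasoning

  Pos-injective : ∀ {S T} → 𝔹 R S → 𝔹 R T →
                  (∀ j → Pos R S j → Pos R T j) → (∀ j → Pos R T j → Pos R S j) → S ≡ T
  Pos-injective {S} {T} bS bT S⊆T T⊆S = ⊆-antisym (⊆ bS T⊆S S⊆T) (⊆ bT S⊆T T⊆S)
    where
    ⊆ : ∀ {S T} → 𝔹 R S → (∀ j → Pos R T j → Pos R S j) → (∀ j → Pos R S j → Pos R T j) →
        ∀ {j} → j ∈ S → j ∈ T
    ⊆ bS T⊆S S⊆T j∈S =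
      simple-root-∈ bS (λ l l∈T → T⊆S l (∈⇒Pos R l∈T)) j∈S (S⊆T _ (∈⇒Pos R j∈S))

  Neg⊆Pos-of-Neg-basis : ∀ {S T} → 𝔹 R S → 𝔹 R T → (∀ l → l ∈ T → Neg R S l) →
                         ∀ {j} → Neg R S j → Pos R T j
  Neg⊆Pos-of-Neg-basis bS bT T⊆Neg {j} q = ¬Neg⇒Pos bT λ qT →
    Pos⇒¬Neg bS (Neg-neg⇒Pos bS (Neg-trans R T⊆Neg (neg j) (Neg⇒Pos-neg bT qT))) q

  Pos-count≡Neg-count : ∀ {S} (bS : 𝔹 R S) → count (Pos? bS) ≡ count (Neg? bS)
  Pos-count≡Neg-count bS = count-involution (Pos? bS) (Neg? bS) neg neg-involutive
                                            (λ _ → Pos⇒Neg-neg bS) (λ _ → Neg-neg⇒Pos bS)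

  Pos-count+Neg-count : ∀ {S} (bS : 𝔹 R S) → count (Pos? bS) + count (Neg? bS) ≡ m
  Pos-count+Neg-count bS =
    trans (sym (count-split (λ _ → yes tt) (Pos? bS) (Neg? bS) (λ j _ → proj₂ bS j)
                            (λ _ _ → tt) (λ _ _ → tt) (λ _ → Pos⇒¬Neg bS)))
          (count-all (λ _ → yes tt) (λ _ → tt))

  Neg-count-unique : ∀ {S T} (bS : 𝔹 R S) (bT : 𝔹 R T) → count (Neg? bS) ≡ count (Neg? bT)
  Neg-count-unique bS bT = ℕ.*-cancelˡ-≡ _ _ 2 (trans (double bS) (sym (double bT)))
    where
    double : ∀ {S} (bS : 𝔹 R S) → 2 * count (Neg? bS) ≡ m
    double bS = trans (cong (count (Neg? bS) +_) (ℕ.+-identityʳ _))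
                      (trans (cong (_+ count (Neg? bS)) (sym (Pos-count≡Neg-count bS))) (Pos-count+Neg-count bS))

-- Reflections

module _ {n m k : ℕ} {R : Vec (Vec ℤ n) m} (Λ : Labeling R k) where
  open Labeling Λ

  lab-∈ : ∀ {S} → 𝔹 R S → ∀ i → lab S i ∈ S
  lab-∈ {S} bS i = from (lab-onto S bS (lab S i)) (i , refl)

  lookup-lab-ref-self : ∀ {S} → 𝔹 R S → ∀ i → lookup R (lab (ref S i) i) ≡ -ᵥ lookup R (lab S i)
  lookup-lab-ref-self {S} bS i with ref-lab S bS i i
  ... | N , N≡-2 , lab-ref = trans lab-ref (lookup-ext λ p → begin
    lookup (v +ᵥ (N ·ᵥ v)) p         ≡⟨ lookup-+ᵥ v (N ·ᵥ v) p ⟩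
    lookup v p +ℤ lookup (N ·ᵥ v) p  ≡⟨ cong (lookup v p +ℤ_) (lookup-·ᵥ N v p) ⟩
    lookup v p +ℤ N *ℤ lookup v p    ≡⟨ cong (λ N → lookup v p +ℤ N *ℤ lookup v p) (N≡-2 refl) ⟩
    lookup v p +ℤ -[1+ 1 ] *ℤ lookup v p  ≡⟨ x-2x≡-x (lookup v p) ⟩
    - lookup v p                      ≡⟨ Vec.lookup-map p -_ v ⟨
    lookup (-ᵥ v) p                   ∎)
    where
    open ≡-Reasoning
    v : Vec ℤ n
    v = lookup R (lab S i)
    x-2x≡-x : ∀ x → x +ℤ -[1+ 1 ] *ℤ x ≡ - x
    x-2x≡-x = solve 1 (λ x → x :+ con -[1+ 1 ] :* x := :- x) refl
      where open +-*-Solver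

module Reflection {n m k : ℕ} (R : Vec (Vec ℤ n) m) (dist : Distinct R) (red : Reduced R)
                  (Λ : Labeling R k) where
  open RootSystem R dist red
  open Labeling Λ

  lab-ref-self : ∀ {S} → 𝔹 R S → ∀ i → lab (ref S i) i ≡ neg (lab S i)
  lab-ref-self bS i = dist _ _ (trans (lookup-lab-ref-self Λ bS i) (sym (lookup-neg _)))

  module _ {S : Subset m} (bS : 𝔹 R S) (i : Fin k) where
    private
      l : Fin m
      l = lab S i
      bS' : 𝔹 R (ref S i)
      bS' = ref-𝔹 S bS i
      spec : ∀ j → (Pos R (ref S i) j × Neg R S j) ⇔ (lookup R j ≡ -ᵥ lookup R l)
      spec = ref-spec S bS i

    Pos-ref-neg : Pos R (ref S i) (neg l)
    Pos-ref-neg = proj₁ (from (spec (neg l)) (lookup-neg l))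

    Pos-ref⇒ : ∀ {j} → Pos R (ref S i) j → (Pos R S j × j ≢ l) ⊎ j ≡ neg l
    Pos-ref⇒ {j} p with proj₂ bS j
    ... | inj₂ q = inj₂ (dist _ _ (trans (to (spec j) (p , q)) (sym (lookup-neg l))))
    ... | inj₁ p' = inj₁ (p' , λ { refl → Pos⇒¬Neg bS' p (Pos-neg⇒Neg bS' Pos-ref-neg) })

    Pos⇒Pos-ref : ∀ {j} → Pos R S j → j ≢ l → Pos R (ref S i) j
    Pos⇒Pos-ref {j} p j≢l = ¬Neg⇒Pos bS' λ q → j≢l (dist _ _ (begin
      lookup R j                   ≡⟨ -ᵥ-involutive _ ⟨
      -ᵥ (-ᵥ lookup R j)           ≡⟨ cong -ᵥ_ (lookup-neg j) ⟨
      -ᵥ lookup R (neg j)          ≡⟨ cong -ᵥ_ (to (spec (neg j)) (Neg⇒Pos-neg bS' q , Pos⇒Neg-neg bS p)) ⟩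
      -ᵥ (-ᵥ lookup R l)           ≡⟨ -ᵥ-involutive _ ⟩
      lookup R l                   ∎))
      where open ≡-Reasoning

  ref-involutive : ∀ {S} → 𝔹 R S → ∀ i → ref (ref S i) i ≡ S
  ref-involutive {S} bS i = Pos-injective bS'' bS back forth
    where
    S' : Subset m
    S' = ref S i
    bS' : 𝔹 R S'
    bS' = ref-𝔹 S bS i
    bS'' : 𝔹 R (ref S' i)
    bS'' = ref-𝔹 S' bS' i
    l l' : Fin m
    l = lab S i
    l' = lab S' i
    l'≡neg-l : l' ≡ neg l
    l'≡neg-l = lab-ref-self bS i
    neg-l'≡l : neg l' ≡ l
    neg-l'≡l = trans (cong neg l'≡neg-l) (neg-involutive l)
    back : ∀ j → Pos R (ref S' i) j → Pos R S j
    back j p with Pos-ref⇒ bS' i p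
    ... | inj₂ refl = subst (Pos R S) (sym neg-l'≡l) (∈⇒Pos R (lab-∈ Λ bS i))
    ... | inj₁ (p' , j≢l') with Pos-ref⇒ bS i p'
    ...   | inj₁ (p'' , _) = p''
    ...   | inj₂ j≡neg-l = ⊥-elim (j≢l' (trans j≡neg-l (sym l'≡neg-l)))
    forth : ∀ j → Pos R S j → Pos R (ref S' i) j
    forth j p with j ≟ l
    ... | yes refl = subst (Pos R (ref S' i)) neg-l'≡l (Pos-ref-neg bS' i)
    ... | no j≢l = Pos⇒Pos-ref bS' i (Pos⇒Pos-ref bS i p j≢l) λ j≡l' →
            Pos⇒¬Neg bS (∈⇒Pos R (lab-∈ Λ bS i)) (Pos-neg⇒Neg bS (subst (Pos R S) (trans j≡l' l'≡neg-l) p))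


module Inversions {n m k : ℕ} (R : Vec (Vec ℤ n) m) (dist : Distinct R) (red : Reduced R)
                  (Λ : Labeling R k) {S : Subset m} (bS : 𝔹 R S) where
  open RootSystem R dist red
  open Reflection R dist red Λ
  open Labeling Λ

  inv : ∀ {T} → 𝔹 R T → ℕ
  inv bT = count (Pos? bT ∩? Neg? bS)

  inv-cong : ∀ {T T'} (bT : 𝔹 R T) (bT' : 𝔹 R T') → T ≡ T' → inv bT ≡ inv bT'
  inv-cong bT bT' refl = count-cong (Pos? bT ∩? Neg? bS) (Pos? bT' ∩? Neg? bS) (λ _ → id) (λ _ → id)

  inv-self : inv bS ≡ 0
  inv-self = count-∅ (Pos? bS ∩? Neg? bS) λ _ (p , q) → Pos⇒¬Neg bS p q

  inv≡0⇒≡ : ∀ {T} (bT : 𝔹 R T) → inv bT ≡ 0 → T ≡ S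
  inv≡0⇒≡ {T} bT inv≡0 = Pos-injective bT bS T⊆S S⊆T
    where
    T⊆S : ∀ j → Pos R T j → Pos R S j
    T⊆S j p = ¬Neg⇒Pos bS λ q → count≡0⇒∅ (Pos? bT ∩? Neg? bS) inv≡0 j (p , q)
    S⊆T : ∀ j → Pos R S j → Pos R T j
    S⊆T j p = ¬Neg⇒Pos bT λ q → Pos⇒¬Neg bS p (Pos-neg⇒Neg bS (T⊆S (neg j) (Neg⇒Pos-neg bT q)))

  -- Reflecting in a label that is positive for S adds exactly its negative to the inversions.
  inv-ref : ∀ {T} (bT : 𝔹 R T) i → Pos R S (lab T i) → inv (ref-𝔹 T bT i) ≡ suc (inv bT)
  inv-ref {T} bT i p-l = count-insert (Pos? bT ∩? Neg? bS) (Pos? (ref-𝔹 T bT i) ∩? Neg? bS) (neg l)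
    (λ j (p , q) → Data.Sum.map (λ (p' , _) → p' , q) id (Pos-ref⇒ bT i p))
    (λ j (p , q) → Pos⇒Pos-ref bT i p (λ { refl → Pos⇒¬Neg bS p-l q }) , q)
    (Pos-ref-neg bT i , Pos⇒Neg-neg bS p-l)
    (λ (p , _) → Pos⇒¬Neg bT (∈⇒Pos R (lab-∈ Λ bT i)) (Pos-neg⇒Neg bT p))
    where
    l : Fin m
    l = lab T i

  inv≢0⇒Neg-lab : ∀ {T} (bT : 𝔹 R T) → inv bT ≢ 0 → ∃ λ i → Neg R S (lab T i)
  inv≢0⇒Neg-lab {T} bT inv≢0 with any? (λ i → Neg? bS (lab T i))
  ... | yes found = found
  ... | no ¬found =
    ⊥-elim (inv≢0 (count-∅ (Pos? bT ∩? Neg? bS) λ j (p , q) → Pos⇒¬Neg bS (Pos-trans R T⊆S j p) q))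
    where
    T⊆S : ∀ l → l ∈ T → Pos R S l
    T⊆S l l∈T with to (lab-onto T bT l) l∈T
    ... | i , refl = ¬Neg⇒Pos bS λ q → ¬found (i , q)

  inv≡Neg-count⇒opposite : ∀ {T} (bT : 𝔹 R T) → inv bT ≡ count (Neg? bS) → ∀ j → Pos R T j ⇔ Neg R S j
  inv≡Neg-count⇒opposite {T} bT inv≡K j = mk⇔ (T⊆Neg j) (Neg⊆T j)
    where
    Neg⊆T : ∀ j → Neg R S j → Pos R T j
    Neg⊆T = λ j q → proj₁ (count-⊆-≡⇒⊇ (Pos? bT ∩? Neg? bS) (Neg? bS) (λ _ → proj₂) inv≡K j q)
    T⊆Neg : ∀ j → Pos R T j → Neg R S j
    T⊆Neg j p with proj₂ bS j
    ... | inj₂ q = q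
    ... | inj₁ p' = ⊥-elim (Pos⇒¬Neg bT p (Pos-neg⇒Neg bT (Neg⊆T (neg j) (Pos⇒Neg-neg bS p'))))

-- Two labels: the alternating cycle

other : Fin 2 → Fin 2
other zero       = suc zero
other (suc zero) = zero

other-involutive : ∀ i → other (other i) ≡ i
other-involutive zero       = refl
other-involutive (suc zero) = refl

≡∨≡other : ∀ i i' → i' ≡ i ⊎ i' ≡ other i
≡∨≡other zero       zero       = inj₁ refl
≡∨≡other zero       (suc zero) = inj₂ refl
≡∨≡other (suc zero) zero       = inj₂ refl
≡∨≡other (suc zero) (suc zero) = inj₁ refl

alt : Fin 2 → ℕ → Fin 2
alt i zero    = i
alt i (suc t) = alt (other i) t

alt-suc : ∀ i t → alt i (suc t) ≡ other (alt i t)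
alt-suc i zero    = refl
alt-suc i (suc t) = alt-suc (other i) t

alt-+ : ∀ i t s → alt (alt i t) s ≡ alt i (t + s)
alt-+ i zero    s = refl
alt-+ i (suc t) s = alt-+ (other i) t s

alt-even : ∀ i s → alt i (s + s) ≡ i
alt-even i zero    = refl
alt-even i (suc s) rewrite ℕ.+-suc s s = trans (cong (λ i → alt i (s + s)) (other-involutive i)) (alt-even i s)

<⊎≡+ : ∀ t K → t < K ⊎ ∃ λ b → t ≡ K + b
<⊎≡+ zero    (suc K) = inj₁ (s≤s z≤n)
<⊎≡+ t       zero    = inj₂ (t , refl)
<⊎≡+ (suc t) (suc K) with <⊎≡+ t K
... | inj₁ t<K       = inj₁ (s≤s t<K)
... | inj₂ (b , t≡K+b) = inj₂ (b , cong suc t≡K+b)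

module TwoLabels {n m : ℕ} (R : Vec (Vec ℤ n) m) (dist : Distinct R) (red : Reduced R) (Λ : Labeling R 2) where
  open RootSystem R dist red
  open Reflection R dist red Λ
  open Labeling Λ

  chain : Subset m → Fin 2 → ℕ → Subset m
  chain S i zero    = S
  chain S i (suc t) = ref (chain S i t) (alt i t)

  chain-𝔹 : ∀ {S} → 𝔹 R S → ∀ i t → 𝔹 R (chain S i t)
  chain-𝔹 bS i zero    = bS
  chain-𝔹 bS i (suc t) = ref-𝔹 _ (chain-𝔹 bS i t) (alt i t)

  chain-+ : ∀ S i t s → chain S i (t + s) ≡ chain (chain S i t) (alt i t) s
  chain-+ S i t zero    rewrite ℕ.+-identityʳ t = refl
  chain-+ S i t (suc s) rewrite ℕ.+-suc t s = cong₂ ref (chain-+ S i t s) (sym (alt-+ i t s))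

  chain-shift : ∀ S t → chain (ref (ref S zero) (suc zero)) zero t ≡ chain S zero (suc (suc t))
  chain-shift S zero    = refl
  chain-shift S (suc t) = cong (λ X → ref X (alt zero t)) (chain-shift S t)

  endpoint-alternating : ∀ S k → endpoint R Λ S (alternating k) ≡ chain S zero (k + k)
  endpoint-alternating S zero    = refl
  endpoint-alternating S (suc k) =
    trans (endpoint-alternating _ k) (trans (chain-shift S (k + k)) (cong (chain S zero ∘ suc) (sym (ℕ.+-suc k k))))

  InWalk-alternating : ∀ S k S' →
                       InWalk R Λ S (alternating k) S' ⇔ (∃ λ t → t < k + k × S' ≡ chain S zero (suc t))
  InWalk-alternating S k S' = mk⇔ (⇒ S k) (⇐ S k)
    where
    ⇒ : ∀ S k → InWalk R Λ S (alternating k) S' → ∃ λ t → t < k + k × S' ≡ chain S zero (suc t)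
    ⇒ S (suc k) (here S'≡)          = 0 , s≤s z≤n , S'≡
    ⇒ S (suc k) (there (here S'≡))  = 1 , subst (1 <_) (sym (ℕ.+-suc (suc k) k)) (s≤s (s≤s z≤n)) , S'≡
    ⇒ S (suc k) (there (there S'∈)) with ⇒ _ k S'∈
    ... | t , t<2k , S'≡ = suc (suc t) , subst (suc (suc t) <_) (sym (ℕ.+-suc (suc k) k)) (s≤s (s≤s t<2k)) ,
                           trans S'≡ (chain-shift S (suc t))
    ⇐ : ∀ S k → (∃ λ t → t < k + k × S' ≡ chain S zero (suc t)) → InWalk R Λ S (alternating k) S'
    ⇐ S (suc k) (zero , _ , S'≡)           = here S'≡
    ⇐ S (suc k) (suc zero , _ , S'≡)       = there (here S'≡)
    ⇐ S (suc k) (suc (suc t) , t<2k , S'≡) =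
      there (there (⇐ _ k (t , ℕ.≤-pred (ℕ.≤-pred (subst (suc (suc (suc t)) ≤_) (ℕ.+-suc (suc k) k) t<2k)) ,
                           trans S'≡ (sym (chain-shift S (suc t))))))

  length-alternating : ∀ k → length (alternating k) ≡ k + k
  length-alternating zero    = refl
  length-alternating (suc k) = cong suc (trans (cong suc (length-alternating k)) (sym (ℕ.+-suc k k)))

  labels-cover : ∀ {T} → 𝔹 R T → ∀ i {l} → l ∈ T → l ≡ lab T i ⊎ l ≡ lab T (other i)
  labels-cover {T} bT i l∈T with to (lab-onto T bT _) l∈T
  ... | i' , refl with ≡∨≡other i i'
  ...   | inj₁ refl = inj₁ refl
  ...   | inj₂ refl = inj₂ refl

  module HalfTurn {S : Subset m} (bS : 𝔹 R S) (i : Fin 2) where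
    open Inversions R dist red Λ bS public

    K : ℕ
    K = count (Neg? bS)

    T : ℕ → Subset m
    T = chain S i

    bT : ∀ t → 𝔹 R (T t)
    bT = chain-𝔹 bS i

    Invariant : ℕ → Set
    Invariant t = inv (bT t) ≡ t × (∀ t' → t ≡ suc t' → Neg R S (lab (T t) (alt i t')))

    -- If the next label were negative too, both labels and hence all of T t would
    -- be negative for S, forcing inv (bT t) = K.
    next-label-Pos : ∀ t → t < K → Invariant t → Pos R S (lab (T t) (alt i t))
    next-label-Pos zero     _   _                  = ∈⇒Pos R (lab-∈ Λ bS i)
    next-label-Pos (suc t') t<K (inv≡t , last-Neg) = ¬Neg⇒Pos bS λ q →
      ℕ.<-irrefl (trans (sym inv≡t) (inv≡K q)) t<K
      where
      T⊆Neg : Neg R S (lab (T (suc t')) (alt i (suc t'))) → ∀ l → l ∈ T (suc t') → Neg R S l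
      T⊆Neg q l l∈T with labels-cover (bT (suc t')) (alt i t') l∈T
      ... | inj₁ refl = last-Neg t' refl
      ... | inj₂ refl = subst (λ i' → Neg R S (lab (T (suc t')) i')) (alt-suc i t') q
      inv≡K : Neg R S (lab (T (suc t')) (alt i (suc t'))) → inv (bT (suc t')) ≡ K
      inv≡K q = count-cong (Pos? (bT (suc t')) ∩? Neg? bS) (Neg? bS) (λ _ → proj₂)
                  (λ j q' → Neg⊆Pos-of-Neg-basis bS (bT (suc t')) (T⊆Neg q) q' , q')

    invariant : ∀ t → t ≤ K → Invariant t
    invariant zero    _   = inv-self , λ _ ()
    invariant (suc t) t<K = trans (inv-ref (bT t) (alt i t) p-l) (cong suc (proj₁ IH)) ,
                            λ { t' refl → subst (Neg R S) (sym (lab-ref-self (bT t) (alt i t))) (Pos⇒Neg-neg bS p-l) }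
      where
      IH : Invariant t
      IH = invariant t (ℕ.<⇒≤ t<K)
      p-l : Pos R S (lab (T t) (alt i t))
      p-l = next-label-Pos t t<K IH

    opposite : ∀ j → Pos R (T K) j ⇔ Neg R S j
    opposite = inv≡Neg-count⇒opposite (bT K) (proj₁ (invariant K ℕ.≤-refl))

  -- B 0 = S, …, B K = S' (the opposite basis), …, B (K + K) = S: two half turns.
  module Cycle {S : Subset m} (bS : 𝔹 R S) where
    module First = HalfTurn bS zero
    open First using (K)

    B : ℕ → Subset m
    B = chain S zero

    bB : ∀ t → 𝔹 R (B t)
    bB = chain-𝔹 bS zero

    module Second = HalfTurn (bB K) (alt zero K)

    S' : Subset m
    S' = B K

    Neg-count≡K : ∀ {T} (bT : 𝔹 R T) → count (Neg? bT) ≡ K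
    Neg-count≡K bT = Neg-count-unique bT bS

    K≥1 : 1 ≤ K
    K≥1 = ℕ.n≢0⇒n>0 λ K≡0 →
      count≡0⇒∅ (Neg? bS) K≡0 _ (Pos⇒Neg-neg bS (∈⇒Pos R (lab-∈ Λ bS zero)))

    B-second : ∀ s → B (K + s) ≡ Second.T s
    B-second = chain-+ S zero K

    Neg-S'⇒Pos-S : ∀ {j} → Neg R S' j → Pos R S j
    Neg-S'⇒Pos-S q = Neg-neg⇒Pos bS (to (First.opposite _) (Neg⇒Pos-neg (bB K) q))

    Pos-S⇒Neg-S' : ∀ {j} → Pos R S j → Neg R S' j
    Pos-S⇒Neg-S' p = Pos-neg⇒Neg (bB K) (from (First.opposite _) (Pos⇒Neg-neg bS p))

    B-closed : B (K + K) ≡ S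
    B-closed = trans (B-second K) (subst (λ K' → Second.T K' ≡ S) (Neg-count≡K (bB K))
      (Pos-injective (Second.bT Second.K) bS
        (λ j p → Neg-S'⇒Pos-S (to (Second.opposite j) p))
        (λ j p → from (Second.opposite j) (Pos-S⇒Neg-S' p))))

    inv-sum : ∀ {T} (bT : 𝔹 R T) → First.inv bT + Second.inv bT ≡ K
    inv-sum bT = trans (sym (count-split (Pos? bT) (Pos? bT ∩? Neg? bS) (Pos? bT ∩? Neg? (bB K))
                                            sort (λ _ → proj₁) (λ _ → proj₁)
                                            (λ _ (_ , q) (_ , q') → Pos⇒¬Neg bS (Neg-S'⇒Pos-S q') q)))
                       (trans (Pos-count≡Neg-count bT) (Neg-count≡K bT))
      where
      sort : ∀ j → Pos R _ j → (Pos R _ j × Neg R S j) ⊎ (Pos R _ j × Neg R S' j)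
      sort j p with proj₂ bS j
      ... | inj₁ p' = inj₂ (p , Pos-S⇒Neg-S' p')
      ... | inj₂ q  = inj₁ (p , q)

    first-half : ∀ t → t < K → First.inv (bB (suc t)) ≡ suc t × Neg R S (lab (B (suc t)) (alt zero t))
    first-half t t<K = proj₁ invariant , proj₂ invariant t refl
      where
      invariant : First.Invariant (suc t)
      invariant = First.invariant (suc t) t<K

    second-half : ∀ t b → b < K → suc t ≡ K + suc b →
                  Second.inv (bB (suc t)) ≡ suc b × Pos R S (lab (B (suc t)) (alt zero (K + b)))
    second-half t b b<K t≡K+b =
      trans (Second.inv-cong (bB (suc t)) (Second.bT (suc b)) B≡) (proj₁ invariant) ,
      Neg-S'⇒Pos-S (subst₂ (λ X i → Neg R S' (lab X i)) (sym B≡) (alt-+ zero K b) (proj₂ invariant b refl))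
      where
      invariant : Second.Invariant (suc b)
      invariant = Second.invariant (suc b) (subst (suc b ≤_) (sym (Neg-count≡K (bB K))) b<K)
      B≡ : B (suc t) ≡ Second.T (suc b)
      B≡ = trans (cong B t≡K+b) (B-second (suc b))

    position : ∀ t → t < K + K → t < K ⊎ ∃ λ b → b < K × suc t ≡ K + suc b
    position t t<2K with <⊎≡+ t K
    ... | inj₁ t<K         = inj₁ t<K
    ... | inj₂ (b , refl)  = inj₂ (b , ℕ.+-cancelˡ-< K b K t<2K , sym (ℕ.+-suc K b))

    -- B (suc t) and B (suc t') with t < K ≤ t' have the same inversion count only if t' = 2K - 2 - t;
    -- then they carry the same label index, negative for S in the first and positive in the second.
    halves-disjoint : ∀ t t' b → t < K → b < K → suc t' ≡ K + suc b → B (suc t) ≢ B (suc t')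
    halves-disjoint t t' b t<K b<K t'≡K+b B≡ = Pos⇒¬Neg bS Pos-lab' (proj₂ (first-half t t<K))
      where
      inv-total : suc t + suc b ≡ K
      inv-total = trans (cong₂ _+_ (sym (proj₁ (first-half t t<K)))
                                   (trans (sym (proj₁ (second-half t' b b<K t'≡K+b)))
                                          (Second.inv-cong (bB (suc t')) (bB (suc t)) (sym B≡))))
                        (inv-sum (bB (suc t)))
      same-index : alt zero (K + b) ≡ alt zero t
      same-index = begin
        alt zero (K + b)                       ≡⟨ cong (λ K → alt zero (K + b)) (sym inv-total) ⟩
        alt zero ((suc t + suc b) + b)         ≡⟨ cong (alt zero) (rearrange t b) ⟩
        alt zero (t + (suc b + suc b))         ≡⟨ alt-+ zero t (suc b + suc b) ⟨
        alt (alt zero t) (suc b + suc b)       ≡⟨ alt-even (alt zero t) (suc b) ⟩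
        alt zero t                             ∎
        where
        open ≡-Reasoning
        rearrange : ∀ t b → (suc t + suc b) + b ≡ t + (suc b + suc b)
        rearrange = solve 2 (λ t b → (con 1 :+ t :+ (con 1 :+ b)) :+ b := t :+ ((con 1 :+ b) :+ (con 1 :+ b))) refl
          where open ℕ-Solver.+-*-Solver
      Pos-lab' : Pos R S (lab (B (suc t)) (alt zero t))
      Pos-lab' = subst₂ (λ X i → Pos R S (lab X i)) (sym B≡) same-index (proj₂ (second-half t' b b<K t'≡K+b))

    B-injective : ∀ {t t'} → t < K + K → t' < K + K → B (suc t) ≡ B (suc t') → t ≡ t'
    B-injective {t} {t'} t<2K t'<2K B≡ with position t t<2K | position t' t'<2K
    ... | inj₁ t<K | inj₁ t'<K =
      ℕ.suc-injective (trans (sym (proj₁ (first-half t t<K)))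
                             (trans (First.inv-cong (bB (suc t)) (bB (suc t')) B≡) (proj₁ (first-half t' t'<K))))
    ... | inj₂ (b , b<K , t≡) | inj₂ (b' , b'<K , t'≡) =
      ℕ.suc-injective (trans t≡ (trans (cong (K +_) b≡b') (sym t'≡)))
      where
      b≡b' : suc b ≡ suc b'
      b≡b' = trans (sym (proj₁ (second-half t b b<K t≡)))
                   (trans (Second.inv-cong (bB (suc t)) (bB (suc t')) B≡) (proj₁ (second-half t' b' b'<K t'≡)))
    ... | inj₁ t<K | inj₂ (b' , b'<K , t'≡) = ⊥-elim (halves-disjoint t t' b' t<K b'<K t'≡ B≡)
    ... | inj₂ (b , b<K , t≡) | inj₁ t'<K = ⊥-elim (halves-disjoint t' t b t'<K b<K t≡ (sym B≡))

    Visited : Subset m → Set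
    Visited T = ∃ λ t → t < K + K × T ≡ B (suc t)

    K+K≡suc : K + K ≡ suc (pred K + K)
    K+K≡suc with K | K≥1
    ... | suc _ | _ = refl

    S-visited : Visited S
    S-visited = pred K + K , subst (suc (pred K + K) ≤_) (sym K+K≡suc) ℕ.≤-refl ,
                sym (trans (cong B (sym K+K≡suc)) B-closed)

    B-back : ∀ t → ref (B (suc t)) (other (alt zero (suc t))) ≡ B t
    B-back t = trans (cong (ref (B (suc t))) (trans (cong other (alt-suc zero t)) (other-involutive _)))
                     (ref-involutive (bB t) (alt zero t))

    visited-ref : ∀ {T} → Visited T → ∀ i → Visited (ref T i)
    visited-ref (t , t<2K , refl) i with ≡∨≡other (alt zero (suc t)) i
    ... | inj₁ refl with suc t ℕ.<? K + K
    ...   | yes t+1<2K = suc t , t+1<2K , refl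
    ...   | no  t+1≮2K = zero , subst (1 ≤_) (sym K+K≡suc) (s≤s z≤n) ,
                         cong₂ ref (trans (cong B t+1≡2K) B-closed) (trans (cong (alt zero) t+1≡2K) (alt-even zero K))
      where
      t+1≡2K : suc t ≡ K + K
      t+1≡2K = ℕ.≤-antisym t<2K (ℕ.≮⇒≥ t+1≮2K)
    visited-ref (t , t<2K , refl) i | inj₂ refl = step-back t t<2K
      where
      step-back : ∀ t → t < K + K → Visited (ref (B (suc t)) (other (alt zero (suc t))))
      step-back zero      _    = subst Visited (sym (B-back zero)) S-visited
      step-back (suc t'') t<2K = t'' , ℕ.<⇒≤ t<2K , B-back (suc t'')

    -- Induction on the number of inversions: reflecting T in a label that is negative
    -- for S gives a basis with one inversion less, from which T is one step away.
    all-visited : ∀ {T} → 𝔹 R T → Visited T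
    all-visited bT = go _ bT refl
      where
      go : ∀ d {T} (bT : 𝔹 R T) → First.inv bT ≡ d → Visited T
      go zero    bT inv≡0 = subst Visited (sym (First.inv≡0⇒≡ bT inv≡0)) S-visited
      go (suc d) {T} bT inv≡d+1 = subst Visited (ref-involutive bT i) (visited-ref (go d bT' inv'≡d) i)
        where
        Neg-lab : ∃ λ i → Neg R S (lab T i)
        Neg-lab = First.inv≢0⇒Neg-lab bT (λ inv≡0 → ℕ.0≢1+n (trans (sym inv≡0) inv≡d+1))
        i : Fin 2
        i = proj₁ Neg-lab
        bT' : 𝔹 R (ref T i)
        bT' = ref-𝔹 T bT i
        bT'' : 𝔹 R (ref (ref T i) i)
        bT'' = ref-𝔹 (ref T i) bT' i
        Pos-l' : Pos R S (lab (ref T i) i)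
        Pos-l' = subst (Pos R S) (sym (lab-ref-self bT i)) (Neg⇒Pos-neg bS (proj₂ Neg-lab))
        inv'≡d : First.inv bT' ≡ d
        inv'≡d = ℕ.suc-injective (begin
          suc (First.inv bT')                    ≡⟨ First.inv-ref bT' i Pos-l' ⟨
          First.inv bT''                         ≡⟨ First.inv-cong bT'' bT (ref-involutive bT i) ⟩
          First.inv bT                           ≡⟨ inv≡d+1 ⟩
          suc d                                  ∎)
          where open ≡-Reasoning

    size : HasSize R (𝔹 R) (K + K)
    size = f , f-injective , λ T → mk⇔ (f-onto T) (λ { (t , refl) → bB (suc (toℕ t)) })
      where
      f : Fin (K + K) → Subset m
      f t = B (suc (toℕ t))
      f-injective : ∀ t t' → f t ≡ f t' → t ≡ t'
      f-injective t t' f≡ = Fin.toℕ-injective (B-injective (Fin.toℕ<n t) (Fin.toℕ<n t') f≡)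
      f-onto : ∀ T → 𝔹 R T → ∃ λ t → f t ≡ T
      f-onto T bT with all-visited bT
      ... | t , t<2K , refl = fromℕ< t<2K , cong (B ∘ suc) (Fin.toℕ-fromℕ< t<2K)

    hamiltonian : Hamiltonian R Λ S (alternating K)
    hamiltonian =
      subst (HasSize R (𝔹 R)) (sym (length-alternating K)) size ,
      trans (endpoint-alternating S K) B-closed ,
      λ T → mk⇔ (λ bT → from (InWalk-alternating S K T) (all-visited bT))
                (λ T∈ → visited-𝔹 (to (InWalk-alternating S K T) T∈))
      where
      visited-𝔹 : ∀ {T} → Visited T → 𝔹 R T
      visited-𝔹 (t , _ , refl) = bB (suc t)

rank-two : ∀ {n m} (R : Vec (Vec ℤ n) m) → Distinct R → IsFGRS R → (Λ : Labeling R 2) →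
           ∃ λ k → 1 ≤ k × HasSize R (𝔹 R) (2 * k) ×
                   ((S : Subset m) → 𝔹 R S → Hamiltonian R Λ S (alternating k))
rank-two R dist ((S₀ , bS₀) , red , _) Λ =
  K , K≥1 , subst (HasSize R (𝔹 R)) (cong (K +_) (sym (ℕ.+-identityʳ K))) size ,
  λ S bS → subst (Hamiltonian R Λ S ∘ alternating) (Neg-count-unique bS bS₀)
                 (TwoLabels.Cycle.hamiltonian R dist red Λ bS)
  where
  open RootSystem R dist red
  open TwoLabels.Cycle R dist red Λ bS₀
  K : ℕ
  K = First.K

-- One label

infix 4 _≡±_
_≡±_ : ∀ {n} → Vec ℤ n → Vec ℤ n → Set
v ≡± w = v ≡ w ⊎ v ≡ -ᵥ w

≡±-sym : ∀ {n} {v w : Vec ℤ n} → v ≡± w → w ≡± v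
≡±-sym (inj₁ refl) = inj₁ refl
≡±-sym {w = w} (inj₂ refl) = inj₂ (sym (-ᵥ-involutive w))

≡±-trans : ∀ {n} {u v w : Vec ℤ n} → u ≡± v → v ≡± w → u ≡± w
≡±-trans (inj₁ refl) v≡±w         = v≡±w
≡±-trans (inj₂ refl) (inj₁ refl)  = inj₂ refl
≡±-trans (inj₂ refl) (inj₂ refl)  = inj₁ (-ᵥ-involutive _)

unit·ᵥ : ∀ {n} {z} (v : Vec ℤ n) → z ≡ 1ℤ ⊎ z ≡ -1ℤ → z ·ᵥ v ≡± v
unit·ᵥ v (inj₁ refl) = inj₁ (·ᵥ-identityˡ v)
unit·ᵥ v (inj₂ refl) = inj₂ (-1·ᵥ v)

*≡1⇒unit : ∀ x y → x *ℤ y ≡ 1ℤ → y ≡ 1ℤ ⊎ y ≡ -1ℤ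
*≡1⇒unit x y xy≡1 =
  ∣∣≡1 y (ℕ.m*n≡1⇒n≡1 ℤ.∣ x ∣ ℤ.∣ y ∣ (trans (sym (ℤ.abs-* x y)) (cong ℤ.∣_∣ xy≡1)))
  where
  ∣∣≡1 : ∀ y → ℤ.∣ y ∣ ≡ 1 → y ≡ 1ℤ ⊎ y ≡ -1ℤ
  ∣∣≡1 (ℤ.+ 1)   _ = inj₁ refl
  ∣∣≡1 -[1+ 0 ] _ = inj₂ refl

singleton-unique : ∀ {n m} (R : Vec (Vec ℤ n) m) {v S S'} → IsSingleton R v S → IsSingleton R v S' → S ≡ S'
singleton-unique R S≡v S'≡v =
  ⊆-antisym (λ j∈S → from (S'≡v _) (to (S≡v _) j∈S)) (λ j∈S' → from (S≡v _) (to (S'≡v _) j∈S'))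

module SingleLabel {n m : ℕ} (R : Vec (Vec ℤ n) m) (dist : Distinct R) (red : Reduced R) (Λ : Labeling R 1) where
  open Labeling Λ

  𝔹⇒singleton : ∀ {S} → 𝔹 R S → IsSingleton R (lookup R (lab S zero)) S
  𝔹⇒singleton {S} bS j = mk⇔ (λ j∈S → cong (lookup R) (sym (∈⇒≡lab j∈S)))
                              (λ R_j≡ → subst (_∈ S) (sym (dist _ _ R_j≡)) (lab-∈ Λ bS zero))
    where
    ∈⇒≡lab : ∀ {j} → j ∈ S → lab S zero ≡ j
    ∈⇒≡lab j∈S with to (lab-onto S bS _) j∈S
    ... | zero , lab≡ = lab≡

  ref-singleton : ∀ {S v} → 𝔹 R S → IsSingleton R v S → IsSingleton R (-ᵥ v) (ref S zero)
  ref-singleton {S} {v} bS S≡v = subst (λ w → IsSingleton R w (ref S zero))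
    (trans (lookup-lab-ref-self Λ bS zero) (cong -ᵥ_ (to (S≡v _) (lab-∈ Λ bS zero))))
    (𝔹⇒singleton (ref-𝔹 S bS zero))

  -- A root is an integer multiple of the only basis vector, hence ± it as R is reduced.
  roots≡±basis : ∀ {S} → 𝔹 R S → ∀ l → lookup R l ≡± lookup R (lab S zero)
  roots≡±basis {S} bS l with proj₁ (proj₁ bS) (lookup R l)
  ... | c , c-supp , c-comb = subst (_≡± lookup R j) c-comb
    (subst (_≡± lookup R j) (sym (comb-single-support R S⊆j c-supp))
      (unit·ᵥ (lookup R j) (proj₂ red j l (c j) (trans (sym c-comb) (comb-single-support R S⊆j c-supp)))))
    where
    j : Fin m
    j = lab S zero
    S⊆j : ∀ {l} → l ∈ S → l ≡ j
    S⊆j l∈S = dist _ _ (to (𝔹⇒singleton bS _) l∈S)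

∈R-neg : ∀ {n m} (R : Vec (Vec ℤ n) m) → Reduced R → ∀ {v} → v ∈R R → (-ᵥ v) ∈R R
∈R-neg R red (j , refl) = proj₁ red j

x≡-x⇒x≡0 : ∀ {x} → x ≡ - x → x ≡ 0ℤ
x≡-x⇒x≡0 {ℤ.+ zero} _ = refl

module RankOne {m : ℕ} (R : Vec (Vec ℤ 1) m) (dist : Distinct R) (red : Reduced R)
               {S₀ : Subset m} (bS₀ : 𝔹 R S₀) (a : ℤ) (gen : (v : Vec ℤ 1) → ∃ λ z → v ≡ z ·ᵥ (a ∷ []))
               (Λ : Labeling R 1) where
  open SingleLabel R dist red Λ
  open Reflection R dist red Λ using (ref-involutive)
  open Labeling Λ

  α : Vec ℤ 1
  α = a ∷ []

  a≢0 : a ≢ 0ℤ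
  a≢0 refl with gen (1ℤ ∷ [])
  ... | w , 1≡w·0 with trans (cong (λ v → lookup v zero) 1≡w·0) (ℤ.*-zeroʳ w)
  ...   | ()

  α≢-α : α ≢ -ᵥ α
  α≢-α α≡-α = a≢0 (x≡-x⇒x≡0 (cong (λ v → lookup v zero) α≡-α))

  β : Vec ℤ 1
  β = lookup R (lab S₀ zero)

  -- β = z α by assumption and α = c β since S₀ is a basis, so c z = 1.
  β≡±α : β ≡± α
  β≡±α with gen β | proj₁ (proj₁ bS₀) α
  ... | z , β≡zα | c , c-supp , c-comb = subst (_≡± α) (sym β≡zα) (unit·ᵥ α (*≡1⇒unit (c j) z cz≡1))
    where
    j : Fin m
    j = lab S₀ zero
    α≡czα : α ≡ (c j *ℤ z) ·ᵥ α
    α≡czα = begin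
      α                       ≡⟨ c-comb ⟨
      comb R c                ≡⟨ comb-single-support R (dist _ _ ∘ to (𝔹⇒singleton bS₀ _)) c-supp ⟩
      c j ·ᵥ β                ≡⟨ cong (c j ·ᵥ_) β≡zα ⟩
      c j ·ᵥ (z ·ᵥ α)         ≡⟨ ·ᵥ-assoc (c j) z α ⟩
      (c j *ℤ z) ·ᵥ α         ∎
      where open ≡-Reasoning
    cz≡1 : c j *ℤ z ≡ 1ℤ
    cz≡1 = ℤ.*-cancelʳ-≡ (c j *ℤ z) 1ℤ a {{ℤ.≢-nonZero a≢0}}
             (trans (sym (cong (λ v → lookup v zero) α≡czα)) (sym (ℤ.*-identityˡ a)))

  root≡±α : ∀ l → lookup R l ≡± α
  root≡±α l = ≡±-trans (roots≡±basis bS₀ l) β≡±α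

  roots : (v : Vec ℤ 1) → v ∈R R ⇔ v ≡± α
  roots v = mk⇔ (λ { (l , refl) → root≡±α l }) (λ v≡±α → ≡±β⇒∈R (≡±-trans v≡±α (≡±-sym β≡±α)))
    where
    ≡±β⇒∈R : ∀ {v} → v ≡± β → v ∈R R
    ≡±β⇒∈R (inj₁ refl) = lab S₀ zero , refl
    ≡±β⇒∈R (inj₂ refl) = ∈R-neg R red (lab S₀ zero , refl)

  singleton⇒𝔹 : ∀ {v S} → v ≡± α → IsSingleton R v S → 𝔹 R S
  singleton⇒𝔹 v≡±α S≡v with ≡±-trans v≡±α (≡±-sym β≡±α)
  ... | inj₁ refl = subst (𝔹 R) (singleton-unique R (𝔹⇒singleton bS₀) S≡v) bS₀
  ... | inj₂ refl =
    subst (𝔹 R) (singleton-unique R (ref-singleton bS₀ (𝔹⇒singleton bS₀)) S≡v) (ref-𝔹 S₀ bS₀ zero)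

  ¬α∧-α : ∀ {X} → IsSingleton R α X → IsSingleton R (-ᵥ α) X → ⊥
  ¬α∧-α X≡α X≡-α with from (roots α) (inj₁ refl)
  ... | j , R_j≡α = α≢-α (trans (sym R_j≡α) (to (X≡-α j) (from (X≡α j) R_j≡α)))

  bases : (S : Subset m) → 𝔹 R S ⇔ (IsSingleton R α S ⊎ IsSingleton R (-ᵥ α) S)
  bases S = mk⇔ (λ bS → by-sign (root≡±α (lab S zero)) (𝔹⇒singleton bS))
                 [ singleton⇒𝔹 (inj₁ refl) , singleton⇒𝔹 (inj₂ refl) ]
    where
    by-sign : ∀ {v} → v ≡± α → IsSingleton R v S → IsSingleton R α S ⊎ IsSingleton R (-ᵥ α) S
    by-sign (inj₁ refl) = inj₁
    by-sign (inj₂ refl) = inj₂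

  Opposite : Subset m → Subset m → Set
  Opposite X Y = (IsSingleton R α X × IsSingleton R (-ᵥ α) Y) ⊎ (IsSingleton R (-ᵥ α) X × IsSingleton R α Y)

  ref-opposite : ∀ {S} → 𝔹 R S → Opposite S (ref S zero)
  ref-opposite {S} bS with to (bases S) bS
  ... | inj₁ S≡α  = inj₁ (S≡α , ref-singleton bS S≡α)
  ... | inj₂ S≡-α = inj₂ (S≡-α , subst (λ v → IsSingleton R v (ref S zero)) (-ᵥ-involutive α)
                                       (ref-singleton bS S≡-α))

  edges : (S T : Subset m) → Edge R Λ S T ⇔ Opposite S T
  edges S T = mk⇔ ⇒ ⇐
    where
    ⇒ : Edge R Λ S T → Opposite S T
    ⇒ (_ , bX , zero , inj₁ (refl , refl)) = ref-opposite bX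
    ⇒ (_ , bX , zero , inj₂ (refl , refl)) =
      Data.Sum.map Data.Product.swap Data.Product.swap (Data.Sum.swap (ref-opposite bX))
    ⇐ : Opposite S T → Edge R Λ S T
    ⇐ S-T = S , bS , zero , inj₁ (refl , T≡ref S-T (ref-opposite bS))
      where
      bS : 𝔹 R S
      bS = [ singleton⇒𝔹 (inj₁ refl) ∘ proj₁ , singleton⇒𝔹 (inj₂ refl) ∘ proj₁ ] S-T
      T≡ref : Opposite S T → Opposite S (ref S zero) → T ≡ ref S zero
      T≡ref (inj₁ (_ , T≡-α))  (inj₁ (_ , ref≡-α)) = singleton-unique R T≡-α ref≡-α
      T≡ref (inj₂ (_ , T≡α))   (inj₂ (_ , ref≡α))  = singleton-unique R T≡α ref≡α
      T≡ref (inj₁ (S≡α , _))   (inj₂ (S≡-α , _))   = ⊥-elim (¬α∧-α S≡α S≡-α)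
      T≡ref (inj₂ (S≡-α , _))  (inj₁ (S≡α , _))    = ⊥-elim (¬α∧-α S≡α S≡-α)

  hamiltonian : (S : Subset m) → IsSingleton R α S → Hamiltonian R Λ S (zero ∷ zero ∷ [])
  hamiltonian S S≡α =
    (f , f-injective , λ T → mk⇔ (f-onto T) λ { (t , refl) → f-𝔹 t }) ,
    ref-involutive bS zero ,
    λ T → mk⇔ (visit T) visited
    where
    bS : 𝔹 R S
    bS = singleton⇒𝔹 (inj₁ refl) S≡α
    S₁ : Subset m
    S₁ = ref S zero
    bS₁ : 𝔹 R S₁
    bS₁ = ref-𝔹 S bS zero
    f : Fin 2 → Subset m
    f zero       = S₁
    f (suc zero) = S
    f-𝔹 : ∀ t → 𝔹 R (f t)
    f-𝔹 zero       = bS₁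
    f-𝔹 (suc zero) = bS
    S₁≢S : S₁ ≢ S
    S₁≢S S₁≡S = ¬α∧-α S≡α (subst (IsSingleton R (-ᵥ α)) S₁≡S (ref-singleton bS S≡α))
    f-injective : ∀ t t' → f t ≡ f t' → t ≡ t'
    f-injective zero       zero       _  = refl
    f-injective (suc zero) (suc zero) _  = refl
    f-injective zero       (suc zero) e  = ⊥-elim (S₁≢S e)
    f-injective (suc zero) zero       e  = ⊥-elim (S₁≢S (sym e))
    f-onto : ∀ T → 𝔹 R T → ∃ λ t → f t ≡ T
    f-onto T bT with to (bases T) bT
    ... | inj₁ T≡α  = suc zero , singleton-unique R S≡α T≡α
    ... | inj₂ T≡-α = zero , singleton-unique R (ref-singleton bS S≡α) T≡-α
    visit : ∀ T → 𝔹 R T → InWalk R Λ S (zero ∷ zero ∷ []) T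
    visit T bT with f-onto T bT
    ... | zero     , refl = here refl
    ... | suc zero , refl = there (here (sym (ref-involutive bS zero)))
    visited : ∀ {T} → InWalk R Λ S (zero ∷ zero ∷ []) T → 𝔹 R T
    visited (here refl)         = bS₁
    visited (there (here refl)) = ref-𝔹 S₁ bS₁ zero

rank-one : ∀ {m} (R : Vec (Vec ℤ 1) m) → Distinct R → IsFGRS R →
  (α : Vec ℤ 1) → ((v : Vec ℤ 1) → ∃ λ (z : ℤ) → v ≡ z ·ᵥ α) →
  (Λ : Labeling R 1) →
    ((v : Vec ℤ 1) → v ∈R R ⇔ (v ≡ α ⊎ v ≡ -ᵥ α)) ×
    ((S : Subset m) → 𝔹 R S ⇔ (IsSingleton R α S ⊎ IsSingleton R (-ᵥ α) S)) ×
    ((S T : Subset m) → Edge R Λ S T ⇔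
      ((IsSingleton R α S × IsSingleton R (-ᵥ α) T) ⊎
       (IsSingleton R (-ᵥ α) S × IsSingleton R α T))) ×
    ((S : Subset m) → IsSingleton R α S → Hamiltonian R Λ S (zero ∷ zero ∷ []))
rank-one R dist ((S₀ , bS₀) , red , _) (a ∷ []) gen Λ = roots , bases , edges , hamiltonian
  where open RankOne R dist red bS₀ a gen Λ

lemma2p9 :
    -- (1) rank 1, 𝔞 = ℤα, I = {1}
    ((m : ℕ) (R : Vec (Vec ℤ 1) m) → Distinct R → IsFGRS R →
      (α : Vec ℤ 1) → ((v : Vec ℤ 1) → ∃ λ (z : ℤ) → v ≡ z ·ᵥ α) →
      (Λ : Labeling R 1) →
        ((v : Vec ℤ 1) → v ∈R R ⇔ (v ≡ α ⊎ v ≡ -ᵥ α)) ×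
        ((S : Subset m) → 𝔹 R S ⇔ (IsSingleton R α S ⊎ IsSingleton R (-ᵥ α) S)) ×
        ((S T : Subset m) → Edge R Λ S T ⇔
          ((IsSingleton R α S × IsSingleton R (-ᵥ α) T) ⊎
           (IsSingleton R (-ᵥ α) S × IsSingleton R α T))) ×
        ((S : Subset m) → IsSingleton R α S → Hamiltonian R Λ S (zero ∷ zero ∷ []))) ×
    -- (2) rank 2, I = {1,2}, k = |𝔹(R)|/2 ≥ 1, i_{2t-1} = 1, i_{2t} = 2
    ((m : ℕ) (R : Vec (Vec ℤ 2) m) → Distinct R → IsFGRS R →
      (Λ : Labeling R 2) →
        ∃ λ (k : ℕ) → 1 ≤ k × HasSize R (𝔹 R) (2 * k) ×
          ((S : Subset m) → 𝔹 R S → Hamiltonian R Λ S (alternating k)))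
lemma2p9 = (λ _ → rank-one) , (λ _ → rank-two)
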